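{- For $n\ge2$, $-\frac53$ is an eigenvalue of $\Delta^H_n$ with multiplicity $\frac12(3^{n-1}-1)$. A basis of the eigenspace consists of alternating functions around cycles of $H_n$ larger than the smallest cycles (the triangles): namely, for each $2\le k\le n$ and each word $u$ of length $n-k$, the cycle $C_{u,k}$ in $H_n$ with vertex set $\{F_{uju'}(p_0): j\in\{1,2,3\},\ u'\in(\{1,2,3\}\setminus\{j\})^{k-1}\}$ (the cycle surrounding the central hole of the copy of $H_k$ indexed by $u$), and the function equal to $+1$ and $-1$ alternately at consecutive vertices of $C_{u,k}$ and $0$ off $C_{u,k}$. In particular the eigenspace has the homology of $H_{n-1}$ (one basis element for each hole of $H_n$ of scale at least that of $H_2$).
   Context: Let $p_1,p_2,p_3$ be the vertices of a triangle in the plane, $p_0=\frac13(p_1+p_2+p_3)$, $F_j(x)=\frac12(x+p_j)$, $F_w=F_{w_1}\circ\cdots\circ F_{w_m}$ for $w\in\{1,2,3\}^m$, $k^m$ the word $k\cdots k$. $V^G_m=\{F_w(p_j):|w|=m,\ j=1,2,3\}$, $V^H_m=\{F_w(p_0):|w|=m\}$. The graph $J_m$ has vertex set $V^G_m\cup V^H_m$ with edges exactly between $F_w(p_0)$ and $F_w(p_j)$, $j=1,2,3$. The graph $H_m$ has vertex set $V^H_m$, distinct vertices adjacent iff they share a $J_m$-neighbour, plus a loop at each $F_{k^m}(p_0)$, $k=1,2,3$. For a word $u$ of length $m-k$, the copy of $H_k$ indexed by $u$ is the subgraph on $\{F_{uv}(p_0):|v|=k\}$. The Laplacian is $\Delta^H_mf(x)=\frac13\sum_{y\sim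 x}(f(y)-f(x))$ over the three edges at $x$, a loop contributing $0$. Each cycle $C_{u,k}$ has even length $3\cdot2^{k-1}$, so alternating $\pm1$ values are well defined (up to an overall sign). -}

module Defs where

open import Data.Nat using (ℕ; zero; suc; _∸_; _≤_) renaming (_+_ to _+ℕ_)
open import Data.Integer using (+_)
open import Data.Fin using (Fin)
import Data.Fin.Properties as FinP
open import Data.Vec using (Vec; []; _∷_; toList; replicate)
import Data.Vec.Properties as VecP
open import Data.List using (List; []; _∷_; [_]; map; concatMap; foldr; allFin; upTo; _++_)
open import Data.List.Relation.Unary.All using (All)
open import Data.Product using (Σ; ∃; ∃₂; ∃-syntax; _×_; _,_)
open import Data.Product.Properties using (≡-dec)
open import Data.Sum using (_⊎_)
open import Data.Bool using (if_then_else_)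
open import Data.Rational using (ℚ; _+_; _*_; _-_; -_; _/_; ½; 0ℚ; 1ℚ)
import Data.Rational.Properties as ℚP
open import Relation.Binary.PropositionalEquality using (_≡_; _≢_)
open import Relation.Nullary using (Dec; ¬_; _×-dec_; _⊎-dec_; ¬?)
open import Relation.Nullary.Decidable using (⌊_⌋)

-- The triangle is fixed as p₁ = (0,0), p₂ = (1,0), p₃ = (0,1) in ℚ²
-- (every triangle is an affine image of this one, and the affine map
-- conjugates the F_j, so the graphs J_m, H_m do not depend on the choice).
-- The letters 1,2,3 are represented by  Fin 3  (zero ↦ 1, 1 ↦ 2, 2 ↦ 3).

Point : Set
Point = ℚ × ℚ

p : Fin 3 → Point
p Fin.zero                   = (0ℚ , 0ℚ)
p (Fin.suc Fin.zero)         = (1ℚ , 0ℚ)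
p (Fin.suc (Fin.suc Fin.zero)) = (0ℚ , 1ℚ)

-- p₀ = (p₁ + p₂ + p₃) / 3
p₀ : Point
p₀ = (+ 1 / 3 , + 1 / 3)

F : Fin 3 → Point → Point
F j (x , y) with p j
... | (a , b) = (½ * (x + a) , ½ * (y + b))

Word : ℕ → Set
Word m = Vec (Fin 3) m

Fw : ∀ {m} → Word m → Point → Point
Fw []      x = x
Fw (j ∷ w) x = F j (Fw w x)

allWords : (n : ℕ) → List (Word n)
allWords zero    = [ [] ]
allWords (suc n) = concatMap (λ j → map (j ∷_) (allWords n)) (allFin 3)

-- The graph H_n on V^H_n = { F_w(p₀) : |w| = n }, identified with words w.

ShareJNeighbour : ∀ {n} → Word n → Word n → Set
ShareJNeighbour x y = ∃₂ λ (i j : Fin 3) → Fw x (p i) ≡ Fw y (p j)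

HEdge : ∀ {n} → Word n → Word n → Set
HEdge {n} x y =
  (x ≢ y × ShareJNeighbour x y) ⊎ (x ≡ y × ∃ λ (k : Fin 3) → x ≡ replicate n k)

_≟P_ : (a b : Point) → Dec (a ≡ b)
_≟P_ = ≡-dec ℚP._≟_ ℚP._≟_

_≟W_ : ∀ {n} → (a b : Word n) → Dec (a ≡ b)
_≟W_ = VecP.≡-dec FinP._≟_

ShareJNeighbour? : ∀ {n} → (x y : Word n) → Dec (ShareJNeighbour x y)
ShareJNeighbour? x y = FinP.any? λ i → FinP.any? λ j → Fw x (p i) ≟P Fw y (p j)

HEdge? : ∀ {n} → (x y : Word n) → Dec (HEdge x y)
HEdge? {n} x y =
  (¬? (x ≟W y) ×-dec ShareJNeighbour? x y)
  ⊎-dec ((x ≟W y) ×-dec FinP.any? (λ k → x ≟W replicate n k))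

sumℚ : List ℚ → ℚ
sumℚ = foldr _+_ 0ℚ

-- Δ^H_n f(x) = (1/3) Σ_{y ∼ x} (f(y) − f(x))  (a loop contributes f x − f x = 0)
ΔH : (n : ℕ) → (Word n → ℚ) → Word n → ℚ
ΔH n f x =
  (+ 1 / 3) * sumℚ (map (λ y → if ⌊ HEdge? x y ⌋ then f y - f x else 0ℚ) (allWords n))

IsEigenfunction : (n : ℕ) → ℚ → (Word n → ℚ) → Set
IsEigenfunction n λ' f = ∀ x → ΔH n f x ≡ λ' * f x

InCycle : (n k : ℕ) → Word (n ∸ k) → Word n → Set
InCycle n k u x =
  ∃ λ (j : Fin 3) → ∃ λ (u' : Vec (Fin 3) (k ∸ 1)) →
    All (_≢ j) (toList u') × (toList x ≡ toList u ++ (j ∷ toList u'))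

-- φ is an alternating function around C_{u,k}: 0 off the cycle, ±1 on it,
-- and opposite values at consecutive vertices of the cycle (= distinct
-- H_n-adjacent vertices both lying on the cycle).
IsAlternating : (n k : ℕ) → Word (n ∸ k) → (Word n → ℚ) → Set
IsAlternating n k u φ =
  (∀ x → ¬ InCycle n k u x → φ x ≡ 0ℚ)
  × (∀ x → InCycle n k u x → (φ x ≡ 1ℚ) ⊎ (φ x ≡ - 1ℚ))
  × (∀ x y → InCycle n k u x → InCycle n k u y → x ≢ y → ShareJNeighbour x y
       → φ x ≡ - φ y)

scales : ℕ → List ℕ
scales n = map (2 +ℕ_) (upTo (n ∸ 1))

basisIndices : (n : ℕ) → List (Σ ℕ λ k → Word (n ∸ k))
basisIndices n = concatMap (λ k → map (k ,_) (allWords (n ∸ k))) (scales n)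

Family : ℕ → Set
Family n = (k : ℕ) → Word (n ∸ k) → Word n → ℚ

Coeffs : ℕ → Set
Coeffs n = (k : ℕ) → Word (n ∸ k) → ℚ

linComb : (n : ℕ) → Coeffs n → Family n → Word n → ℚ
linComb n c φ x = sumℚ (map (λ { (k , u) → c k u * φ k u x }) (basisIndices n))

AllAlternating : (n : ℕ) → Family n → Set
AllAlternating n φ = ∀ k → 2 ≤ k → k ≤ n → ∀ u → IsAlternating n k u (φ k u)

IsEigenbasis : (n : ℕ) → ℚ → Family n → Set
IsEigenbasis n λ' φ =
  (∀ k → 2 ≤ k → k ≤ n → ∀ u → IsEigenfunction n λ' (φ k u))
  × (∀ c → (∀ x → linComb n c φ x ≡ 0ℚ) → ∀ k → 2 ≤ k → k ≤ n → ∀ u → c k u ≡ 0ℚ)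
  × (∀ f → IsEigenfunction n λ' f → ∃ λ c → ∀ x → f x ≡ linComb n c φ x)

-- Write Lap = 3 ΔH and view H_{m+1} as three copies a H_m joined by the junction edges
-- a bᵐ — b aᵐ.  The alternating function of the outer cycle of a copy satisfies Lap = −5 ·
-- except at two corners of the copy, and there the junction edges of the next level cancel the
-- defect exactly; so every cycle function is a (−5)-eigenfunction of Lap.  The top cycle is the
-- only one seen at the junction point 𝟎 𝟏ᵐ⁺¹, which gives independence by recursion into the copies.
-- Conversely an eigenfunction f sums to 0 (Lap is symmetric) and the eigenvalue equation at the
-- junction vertices makes all sums of f over smallest triangles equal, hence 0; by induction on
-- the level f is then a combination of cycle functions and of the three outer arcs, and the
-- eigenvalue equation at the corners of H_n kills the arcs.  Finally an alternating function
-- on a cycle agrees with its cycle function up to a global sign, the cycle being connected.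

module Submission where

open import Defs
open import Data.Bool using (Bool; true; false; if_then_else_; _∧_)
open import Data.Bool.Properties using (∧-zeroʳ)
open import Data.Empty using (⊥-elim)
open import Data.Fin using (Fin) renaming (zero to fz; suc to fs)
open import Data.Fin.Properties using (all?) renaming (_≟_ to _≟L_)
import Data.Integer as ℤ
open import Data.List as L using (List; []; _∷_; map; concatMap; allFin; _++_; upTo; applyUpTo)
import Data.List.Properties as LP
open import Data.List.Relation.Unary.All as All using (All; []; _∷_)
import Data.List.Relation.Unary.All.Properties as AllP
open import Data.Nat as ℕ using (ℕ; zero; suc; _∸_)
import Data.Nat.DivMod as ℕD
open import Data.Nat.ListAction using (sum)
import Data.Nat.Properties as ℕP
import Data.Nat.Tactic.RingSolver as NS
open import Data.Product using (Σ; ∃; ∃₂; _×_; _,_; proj₁; proj₂; swap)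
open import Data.Rational as Q using (ℚ; 0ℚ; 1ℚ; ½; _+_; _*_; _-_; -_) renaming (_≤_ to _≤ℚ_)
import Data.Rational.Properties as ℚP
open import Data.Sum using (_⊎_; inj₁; inj₂)
open import Data.Unit using (tt)
open import Data.Vec using ([]; _∷_; toList; replicate; _∷ʳ_)
import Data.Vec.Properties as VecP
open import Function using (_∘_)
open import Function.Bundles using (_⇔_; mk⇔; Equivalence)
open import Relation.Binary.PropositionalEquality
open import Relation.Nullary using (¬_; ¬?; Dec; yes; no; does; _⊎-dec_)
open import Relation.Nullary.Decidable using (⌊_⌋; dec⇒maybe; dec-true; dec-false; from-yes; True; toWitness; _→-dec_)
open import Tactic.RingSolver using (solve-∀)
open import Tactic.RingSolver.Core.AlmostCommutativeRing using (AlmostCommutativeRing; fromCommutativeRing)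

ℚ-ring : AlmostCommutativeRing _ _
ℚ-ring = fromCommutativeRing ℚP.+-*-commutativeRing (λ x → dec⇒maybe (0ℚ ℚP.≟ x))

Letter : Set
Letter = Fin 3

-- Finite statements about letters, proved by evaluating every case: the implicit True argument reduces to tt.
by-evaluation₂ : {f g : Letter → Letter → ℚ} {_ : True (all? λ a → all? λ b → f a b ℚP.≟ g a b)} →
                 ∀ a b → f a b ≡ g a b
by-evaluation₂ {_} {_} {ok} = toWitness ok

by-evaluation₃ : {f g : Letter → Letter → Letter → ℚ}
                 {_ : True (all? λ a → all? λ b → all? λ c → f a b c ℚP.≟ g a b c)} →
                 ∀ a b c → f a b c ≡ g a b c
by-evaluation₃ {_} {_} {ok} = toWitness ok

decide₂ : {P : Letter → Letter → Set} (P? : ∀ a b → Dec (P a b)) {_ : True (all? λ a → all? λ b → P? a b)} →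
          ∀ a b → P a b
decide₂ _ {ok} = toWitness ok

decide₃ : {P : Letter → Letter → Letter → Set} (P? : ∀ a b c → Dec (P a b c))
          {_ : True (all? λ a → all? λ b → all? λ c → P? a b c)} →
          ∀ a b c → P a b c
decide₃ _ {ok} = toWitness ok

pattern 𝟎 = fz
pattern 𝟏 = fs fz
pattern 𝟐 = fs (fs fz)

-- Cells of the gasket meet only at junction points

InTriangle : Point → Set
InTriangle (x , y) = (0ℚ ≤ℚ x) × (0ℚ ≤ℚ y) × (x + y ≤ℚ 1ℚ)

p-inTriangle : ∀ i → InTriangle (p i)
p-inTriangle 𝟎 = ℚP.≤-refl , ℚP.≤-refl , ℚP.≤ᵇ⇒≤ tt
p-inTriangle 𝟏 = ℚP.≤ᵇ⇒≤ tt , ℚP.≤-refl , ℚP.≤-refl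
p-inTriangle 𝟐 = ℚP.≤-refl , ℚP.≤ᵇ⇒≤ tt , ℚP.≤-refl

midpoint-inTriangle : ∀ {x y a b} → InTriangle (x , y) → InTriangle (a , b) →
                      InTriangle (½ * (x + a) , ½ * (y + b))
midpoint-inTriangle {x} {y} {a} {b} (x≥0 , y≥0 , x+y≤1) (a≥0 , b≥0 , a+b≤1) =
  half-nonNeg (ℚP.+-mono-≤ x≥0 a≥0) , half-nonNeg (ℚP.+-mono-≤ y≥0 b≥0) ,
  subst (_≤ℚ 1ℚ) (sym (regroup x y a b))
    (ℚP.*-monoˡ-≤-nonNeg ½ {(x + y) + (a + b)} {1ℚ + 1ℚ} (ℚP.+-mono-≤ x+y≤1 a+b≤1))
  where
  half-nonNeg : ∀ {c} → 0ℚ ≤ℚ c → 0ℚ ≤ℚ ½ * c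
  half-nonNeg {c} = ℚP.*-monoˡ-≤-nonNeg ½ {0ℚ} {c}
  regroup : ∀ x y a b → ½ * (x + a) + ½ * (y + b) ≡ ½ * ((x + y) + (a + b))
  regroup = solve-∀ ℚ-ring

F-inTriangle : ∀ j {X} → InTriangle X → InTriangle (F j X)
F-inTriangle 𝟎 h = midpoint-inTriangle h (p-inTriangle 𝟎)
F-inTriangle 𝟏 h = midpoint-inTriangle h (p-inTriangle 𝟏)
F-inTriangle 𝟐 h = midpoint-inTriangle h (p-inTriangle 𝟐)

Fw-p-inTriangle : ∀ {m} (w : Word m) i → InTriangle (Fw w (p i))
Fw-p-inTriangle []      i = p-inTriangle i
Fw-p-inTriangle (j ∷ w) i = F-inTriangle j (Fw-p-inTriangle w i)

½-injective : ∀ {u v} → ½ * u ≡ ½ * v → u ≡ v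
½-injective {u} {v} e = trans (sym (double u)) (trans (cong (λ q → q + q) e) (double v))
  where
  double : ∀ w → ½ * w + ½ * w ≡ w
  double = solve-∀ ℚ-ring

+-cancelʳ : ∀ {x y c} → x + c ≡ y + c → x ≡ y
+-cancelʳ {x} {y} {c} e = trans (sym (cancel x c)) (trans (cong (_- c) e) (cancel y c))
  where
  cancel : ∀ x c → x + c - c ≡ x
  cancel = solve-∀ ℚ-ring

F-injective : ∀ j {X Y} → F j X ≡ F j Y → X ≡ Y
F-injective j {_ , _} {_ , _} e =
  cong₂ _,_ (+-cancelʳ (½-injective (cong proj₁ e))) (+-cancelʳ (½-injective (cong proj₂ e)))

F≡p⇒ : ∀ c b {Z} → InTriangle Z → F c Z ≡ p b → (c ≡ b) × (Z ≡ p b)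
F≡p⇒ c b {z₁ , z₂} h e = go c b (solve-for (cong proj₁ e)) (solve-for (cong proj₂ e)) h
  where
  solve-for : ∀ {z a t} → ½ * (z + a) ≡ t → z ≡ t + t - a
  solve-for {z} {a} e = trans (sym (lemma z a)) (cong (λ q → q + q - a) e)
    where
    lemma : ∀ z a → ½ * (z + a) + ½ * (z + a) - a ≡ z
    lemma = solve-∀ ℚ-ring
  -- off the diagonal, Z = 2 p_b − p_c lies outside the triangle
  go : ∀ c b → z₁ ≡ proj₁ (p b) + proj₁ (p b) - proj₁ (p c)
             → z₂ ≡ proj₂ (p b) + proj₂ (p b) - proj₂ (p c)
             → InTriangle (z₁ , z₂) → (c ≡ b) × ((z₁ , z₂) ≡ p b)
  go 𝟎 𝟎 e₁ e₂ _ = refl , cong₂ _,_ e₁ e₂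
  go 𝟏 𝟏 e₁ e₂ _ = refl , cong₂ _,_ e₁ e₂
  go 𝟐 𝟐 e₁ e₂ _ = refl , cong₂ _,_ e₁ e₂
  go 𝟎 𝟏 refl refl (_ , _ , h₃) = ⊥-elim (ℚP.≤⇒≤ᵇ h₃)
  go 𝟎 𝟐 refl refl (_ , _ , h₃) = ⊥-elim (ℚP.≤⇒≤ᵇ h₃)
  go 𝟏 𝟎 refl refl (h₁ , _ , _) = ⊥-elim (ℚP.≤⇒≤ᵇ h₁)
  go 𝟏 𝟐 refl refl (h₁ , _ , _) = ⊥-elim (ℚP.≤⇒≤ᵇ h₁)
  go 𝟐 𝟎 refl refl (_ , h₂ , _) = ⊥-elim (ℚP.≤⇒≤ᵇ h₂)
  go 𝟐 𝟏 refl refl (_ , h₂ , _) = ⊥-elim (ℚP.≤⇒≤ᵇ h₂)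

both-zero : ∀ {u v} → 0ℚ ≤ℚ u → 0ℚ ≤ℚ v → (u + v) + 1ℚ ≤ℚ 1ℚ → (u ≡ 0ℚ) × (v ≡ 0ℚ)
both-zero {u} {v} u≥0 v≥0 h = ℚP.≤-antisym (ℚP.≤-trans u≤u+v u+v≤0) u≥0 , ℚP.≤-antisym (ℚP.≤-trans v≤u+v u+v≤0) v≥0
  where
  cancel : ∀ w → w + 1ℚ - 1ℚ ≡ w
  cancel = solve-∀ ℚ-ring
  u+v≤0 : u + v ≤ℚ 0ℚ
  u+v≤0 = subst₂ _≤ℚ_ (cancel (u + v)) refl (ℚP.+-monoˡ-≤ (- 1ℚ) h)
  u≤u+v : u ≤ℚ u + v
  u≤u+v = subst (_≤ℚ u + v) (ℚP.+-identityʳ u) (ℚP.+-monoʳ-≤ u v≥0)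
  v≤u+v : v ≤ℚ u + v
  v≤u+v = subst (_≤ℚ u + v) (ℚP.+-identityˡ v) (ℚP.+-monoˡ-≤ v u≥0)

shift : ∀ {x y c} → x + 0ℚ ≡ y + c → y ≡ 0ℚ → x ≡ c
shift {x} {c = c} e refl = trans (sym (ℚP.+-identityʳ x)) (trans e (ℚP.+-identityˡ c))

-- In each case the coordinate equations force two non-negative numbers u, v with u + v + 1 ≤ 1.
junction₀₁ : ∀ {x₁ x₂ y₁ y₂} → InTriangle (x₁ , x₂) → InTriangle (y₁ , y₂) →
             x₁ + 0ℚ ≡ y₁ + 1ℚ → x₂ + 0ℚ ≡ y₂ + 0ℚ → ((x₁ , x₂) ≡ p 𝟏) × ((y₁ , y₂) ≡ p 𝟎)
junction₀₁ {x₁} {x₂} {y₁} {y₂} (_ , _ , x≤1) (y₁≥0 , y₂≥0 , _) e₁ e₂ =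
  cong₂ _,_ (shift e₁ y₁≡0) (shift e₂ y₂≡0) , cong₂ _,_ y₁≡0 y₂≡0
  where
  total : (y₁ + y₂) + 1ℚ ≡ x₁ + x₂
  total = trans (l₁ y₁ y₂) (trans (cong₂ _+_ (sym e₁) (sym e₂)) (l₂ x₁ x₂))
    where l₁ : ∀ a b → (a + b) + 1ℚ ≡ (a + 1ℚ) + (b + 0ℚ)
          l₁ = solve-∀ ℚ-ring
          l₂ : ∀ a b → (a + 0ℚ) + (b + 0ℚ) ≡ a + b
          l₂ = solve-∀ ℚ-ring
  zeros = both-zero y₁≥0 y₂≥0 (subst (_≤ℚ 1ℚ) (sym total) x≤1)
  y₁≡0 = proj₁ zeros
  y₂≡0 = proj₂ zeros

junction₀₂ : ∀ {x₁ x₂ y₁ y₂} → InTriangle (x₁ , x₂) → InTriangle (y₁ , y₂) →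
             x₁ + 0ℚ ≡ y₁ + 0ℚ → x₂ + 0ℚ ≡ y₂ + 1ℚ → ((x₁ , x₂) ≡ p 𝟐) × ((y₁ , y₂) ≡ p 𝟎)
junction₀₂ {x₁} {x₂} {y₁} {y₂} (_ , _ , x≤1) (y₁≥0 , y₂≥0 , _) e₁ e₂ =
  cong₂ _,_ (shift e₁ y₁≡0) (shift e₂ y₂≡0) , cong₂ _,_ y₁≡0 y₂≡0
  where
  total : (y₁ + y₂) + 1ℚ ≡ x₁ + x₂
  total = trans (l₁ y₁ y₂) (trans (cong₂ _+_ (sym e₁) (sym e₂)) (l₂ x₁ x₂))
    where l₁ : ∀ a b → (a + b) + 1ℚ ≡ (a + 0ℚ) + (b + 1ℚ)
          l₁ = solve-∀ ℚ-ring
          l₂ : ∀ a b → (a + 0ℚ) + (b + 0ℚ) ≡ a + b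
          l₂ = solve-∀ ℚ-ring
  zeros = both-zero y₁≥0 y₂≥0 (subst (_≤ℚ 1ℚ) (sym total) x≤1)
  y₁≡0 = proj₁ zeros
  y₂≡0 = proj₂ zeros

junction₁₂ : ∀ {x₁ x₂ y₁ y₂} → InTriangle (x₁ , x₂) → InTriangle (y₁ , y₂) →
             x₁ + 1ℚ ≡ y₁ + 0ℚ → x₂ + 0ℚ ≡ y₂ + 1ℚ → ((x₁ , x₂) ≡ p 𝟐) × ((y₁ , y₂) ≡ p 𝟏)
junction₁₂ {x₁} {x₂} {y₁} {y₂} (x₁≥0 , _ , _) (_ , y₂≥0 , y≤1) e₁ e₂ =
  cong₂ _,_ x₁≡0 (shift e₂ y₂≡0) , cong₂ _,_ (shift (sym e₁) x₁≡0) y₂≡0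
  where
  total : (x₁ + y₂) + 1ℚ ≡ y₁ + y₂
  total = trans (l₁ x₁ y₂) (trans (cong (_+ y₂) e₁) (l₂ y₁ y₂))
    where l₁ : ∀ a b → (a + b) + 1ℚ ≡ (a + 1ℚ) + b
          l₁ = solve-∀ ℚ-ring
          l₂ : ∀ a b → (a + 0ℚ) + b ≡ a + b
          l₂ = solve-∀ ℚ-ring
  zeros = both-zero x₁≥0 y₂≥0 (subst (_≤ℚ 1ℚ) (sym total) y≤1)
  x₁≡0 = proj₁ zeros
  y₂≡0 = proj₂ zeros

F-overlap : ∀ a b {X Y} → a ≢ b → InTriangle X → InTriangle Y → F a X ≡ F b Y → (X ≡ p b) × (Y ≡ p a)
F-overlap 𝟎 𝟎 a≢b _ _ _ = ⊥-elim (a≢b refl)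
F-overlap 𝟏 𝟏 a≢b _ _ _ = ⊥-elim (a≢b refl)
F-overlap 𝟐 𝟐 a≢b _ _ _ = ⊥-elim (a≢b refl)
F-overlap 𝟎 𝟏 {_ , _} {_ , _} _ hX hY e = junction₀₁ hX hY (½-injective (cong proj₁ e)) (½-injective (cong proj₂ e))
F-overlap 𝟎 𝟐 {_ , _} {_ , _} _ hX hY e = junction₀₂ hX hY (½-injective (cong proj₁ e)) (½-injective (cong proj₂ e))
F-overlap 𝟏 𝟐 {_ , _} {_ , _} _ hX hY e = junction₁₂ hX hY (½-injective (cong proj₁ e)) (½-injective (cong proj₂ e))
F-overlap 𝟏 𝟎 _ hX hY e = swap (F-overlap 𝟎 𝟏 (λ ()) hY hX (sym e))
F-overlap 𝟐 𝟎 _ hX hY e = swap (F-overlap 𝟎 𝟐 (λ ()) hY hX (sym e))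
F-overlap 𝟐 𝟏 _ hX hY e = swap (F-overlap 𝟏 𝟐 (λ ()) hY hX (sym e))

F-fixes-p : ∀ b → F b (p b) ≡ p b
F-fixes-p 𝟎 = refl
F-fixes-p 𝟏 = refl
F-fixes-p 𝟐 = refl

F-p-comm : ∀ a b → F a (p b) ≡ F b (p a)
F-p-comm = from-yes (all? λ a → all? λ b → F a (p b) ≟P F b (p a))

Fw-replicate-p : ∀ m b → Fw (replicate m b) (p b) ≡ p b
Fw-replicate-p zero    b = refl
Fw-replicate-p (suc m) b = trans (cong (F b) (Fw-replicate-p m b)) (F-fixes-p b)

Fw≡p⇒replicate : ∀ {m} (y : Word m) i b → Fw y (p i) ≡ p b → y ≡ replicate m b
Fw≡p⇒replicate []      i b e = refl
Fw≡p⇒replicate (c ∷ y) i b e =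
  cong₂ _∷_ (proj₁ c≡b×y-end) (Fw≡p⇒replicate y i b (proj₂ c≡b×y-end))
  where c≡b×y-end = F≡p⇒ c b (Fw-p-inTriangle y i) e

share-∷ : ∀ {m} a {y z : Word m} → ShareJNeighbour y z → ShareJNeighbour (a ∷ y) (a ∷ z)
share-∷ a (i , j , e) = i , j , cong (F a) e

share-∷⁻ : ∀ {m} a {y z : Word m} → ShareJNeighbour (a ∷ y) (a ∷ z) → ShareJNeighbour y z
share-∷⁻ a (i , j , e) = i , j , F-injective a e

share-sym : ∀ {m} {x y : Word m} → ShareJNeighbour x y → ShareJNeighbour y x
share-sym (i , j , e) = j , i , sym e

-- The shared point is F_a(p_b) = F_b(p_a).
share-junction : ∀ m a b → ShareJNeighbour (a ∷ replicate m b) (b ∷ replicate m a)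
share-junction m a b =
  b , a , trans (cong (F a) (Fw-replicate-p m b)) (trans (F-p-comm a b) (cong (F b) (sym (Fw-replicate-p m a))))

share-junction⁻ : ∀ {m} a b (y z : Word m) → a ≢ b → ShareJNeighbour (a ∷ y) (b ∷ z) →
                  (y ≡ replicate m b) × (z ≡ replicate m a)
share-junction⁻ a b y z a≢b (i , j , e) =
  Fw≡p⇒replicate y i b (proj₁ ends) , Fw≡p⇒replicate z j a (proj₂ ends)
  where ends = F-overlap a b a≢b (Fw-p-inTriangle y i) (Fw-p-inTriangle z j) e

Σ₃ : (Letter → ℚ) → ℚ
Σ₃ g = g 𝟎 + (g 𝟏 + (g 𝟐 + 0ℚ))

Σ₃-cong : ∀ {g h} → (∀ a → g a ≡ h a) → Σ₃ g ≡ Σ₃ h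
Σ₃-cong e = cong₂ _+_ (e 𝟎) (cong₂ _+_ (e 𝟏) (cong (_+ 0ℚ) (e 𝟐)))

Σ₃-single : ∀ g c → (∀ a → a ≢ c → g a ≡ 0ℚ) → Σ₃ g ≡ g c
Σ₃-single g 𝟎 off rewrite off 𝟏 (λ ()) | off 𝟐 (λ ()) = ℚP.+-identityʳ _
Σ₃-single g 𝟏 off rewrite off 𝟎 (λ ()) | off 𝟐 (λ ()) = trans (ℚP.+-identityˡ _) (ℚP.+-identityʳ _)
Σ₃-single g 𝟐 off rewrite off 𝟎 (λ ()) | off 𝟏 (λ ()) = trans (ℚP.+-identityˡ _) (trans (ℚP.+-identityˡ _) (ℚP.+-identityʳ _))

Σ₃-+ : ∀ g h → Σ₃ (λ a → g a + h a) ≡ Σ₃ g + Σ₃ h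
Σ₃-+ g h = regroup (g 𝟎) (g 𝟏) (g 𝟐) (h 𝟎) (h 𝟏) (h 𝟐)
  where regroup : ∀ a b c d e f → (a + d) + ((b + e) + ((c + f) + 0ℚ)) ≡ (a + (b + (c + 0ℚ))) + (d + (e + (f + 0ℚ)))
        regroup = solve-∀ ℚ-ring

sumℚ-++ : ∀ {A : Set} (h : A → ℚ) xs ys → sumℚ (map h (xs ++ ys)) ≡ sumℚ (map h xs) + sumℚ (map h ys)
sumℚ-++ h [] ys = sym (ℚP.+-identityˡ _)
sumℚ-++ h (x ∷ xs) ys = trans (cong (h x +_) (sumℚ-++ h xs ys)) (sym (ℚP.+-assoc (h x) _ _))

sumℚ-map : ∀ {A B : Set} (h : B → ℚ) (f : A → B) xs → sumℚ (map h (map f xs)) ≡ sumℚ (map (λ x → h (f x)) xs)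
sumℚ-map h f [] = refl
sumℚ-map h f (x ∷ xs) = cong (h (f x) +_) (sumℚ-map h f xs)

sumℚ-concatMap : ∀ {A B : Set} (h : B → ℚ) (g : A → List B) xs →
  sumℚ (map h (concatMap g xs)) ≡ sumℚ (map (λ x → sumℚ (map h (g x))) xs)
sumℚ-concatMap h g [] = refl
sumℚ-concatMap h g (x ∷ xs) = trans (sumℚ-++ h (g x) (concatMap g xs)) (cong (sumℚ (map h (g x)) +_) (sumℚ-concatMap h g xs))

sumℚ-cong : ∀ {A : Set} {g h : A → ℚ} xs → (∀ x → g x ≡ h x) → sumℚ (map g xs) ≡ sumℚ (map h xs)
sumℚ-cong [] e = refl
sumℚ-cong (x ∷ xs) e = cong₂ _+_ (e x) (sumℚ-cong xs e)

sumℚ-zero : ∀ {A : Set} {g : A → ℚ} xs → (∀ x → g x ≡ 0ℚ) → sumℚ (map g xs) ≡ 0ℚ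
sumℚ-zero [] e = refl
sumℚ-zero (x ∷ xs) e = trans (cong₂ _+_ (e x) (sumℚ-zero xs e)) refl

sumℚ-+ : ∀ {A : Set} (g h : A → ℚ) xs → sumℚ (map (λ x → g x + h x) xs) ≡ sumℚ (map g xs) + sumℚ (map h xs)
sumℚ-+ g h [] = refl
sumℚ-+ g h (x ∷ xs) = trans (cong ((g x + h x) +_) (sumℚ-+ g h xs)) (interchange (g x) (h x) _ _)
  where interchange : ∀ a b c d → (a + b) + (c + d) ≡ (a + c) + (b + d)
        interchange = solve-∀ ℚ-ring

sumℚ-* : ∀ {A : Set} (k : ℚ) (g : A → ℚ) xs → sumℚ (map (λ x → k * g x) xs) ≡ k * sumℚ (map g xs)
sumℚ-* k g [] = sym (ℚP.*-zeroʳ k)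
sumℚ-* k g (x ∷ xs) = trans (cong (k * g x +_) (sumℚ-* k g xs)) (sym (ℚP.*-distribˡ-+ k (g x) _))

sumℚ-neg : ∀ {A : Set} (g : A → ℚ) xs → sumℚ (map (λ x → - g x) xs) ≡ - sumℚ (map g xs)
sumℚ-neg g [] = refl
sumℚ-neg g (x ∷ xs) = trans (cong (- g x +_) (sumℚ-neg g xs)) (sym (ℚP.neg-distrib-+ (g x) _))

sumℚ-Σ₃ : ∀ {A : Set} (h : A → Letter → ℚ) xs → sumℚ (map (λ x → Σ₃ (h x)) xs) ≡ Σ₃ (λ a → sumℚ (map (λ x → h x a) xs))
sumℚ-Σ₃ h [] = refl
sumℚ-Σ₃ h (x ∷ xs) = trans (cong (Σ₃ (h x) +_) (sumℚ-Σ₃ h xs)) (sym (Σ₃-+ (λ a → h x a) (λ a → sumℚ (map (λ y → h y a) xs))))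

sumℚ-swap : ∀ {A B : Set} (g : A → B → ℚ) xs ys →
  sumℚ (map (λ x → sumℚ (map (g x) ys)) xs) ≡ sumℚ (map (λ y → sumℚ (map (λ x → g x y) xs)) ys)
sumℚ-swap g [] ys = sym (sumℚ-zero ys (λ _ → refl))
sumℚ-swap g (x ∷ xs) ys = trans (cong (sumℚ (map (g x) ys) +_) (sumℚ-swap g xs ys))
  (sym (sumℚ-+ (g x) (λ y → sumℚ (map (λ x' → g x' y) xs)) ys))

sum-allWords-suc : ∀ n (h : Word (suc n) → ℚ) → sumℚ (map h (allWords (suc n))) ≡ Σ₃ (λ a → sumℚ (map (λ z → h (a ∷ z)) (allWords n)))
sum-allWords-suc n h = trans (sumℚ-concatMap h (λ j → map (j ∷_) (allWords n)) (allFin 3))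
  (Σ₃-cong (λ a → sumℚ-map h (a ∷_) (allWords n)))

sum-allWords-single : ∀ n (t : Word n → ℚ) w → (∀ z → z ≢ w → t z ≡ 0ℚ) → sumℚ (map t (allWords n)) ≡ t w
sum-allWords-single zero t [] _ = ℚP.+-identityʳ _
sum-allWords-single (suc n) t (c ∷ w) off =
  trans (sum-allWords-suc n t)
  (trans (Σ₃-single _ c other-copy)
         (sum-allWords-single n (λ y → t (c ∷ y)) w (λ y y≢w → off (c ∷ y) (λ e → y≢w (VecP.∷-injectiveʳ e)))))
  where
  other-copy : ∀ a → a ≢ c → sumℚ (map (λ y → t (a ∷ y)) (allWords n)) ≡ 0ℚ
  other-copy a a≢c = sumℚ-zero (allWords n) (λ y → off (a ∷ y) (λ e → a≢c (VecP.∷-injectiveˡ e)))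

infix 4 _==_
_==_ : Letter → Letter → Bool
a == b = does (a ≟L b)

==-refl : ∀ a → (a == a) ≡ true
==-refl a = dec-true (a ≟L a) refl

==⇒≡ : ∀ a b → (a == b) ≡ true → a ≡ b
==⇒≡ a b e with a ≟L b
... | yes a≡b = a≡b

≢⇒==-false : ∀ a b → a ≢ b → (a == b) ≡ false
≢⇒==-false a b = dec-false (a ≟L b)

isConst : ∀ {m} → Letter → Word m → Bool
isConst c [] = true
isConst c (d ∷ y) = (d == c) ∧ isConst c y

isConst⇒≡replicate : ∀ {m} c (y : Word m) → isConst c y ≡ true → y ≡ replicate m c
isConst⇒≡replicate c [] _ = refl
isConst⇒≡replicate c (d ∷ y) e with (d == c) in eq
isConst⇒≡replicate c (d ∷ y) e | true = cong₂ _∷_ (==⇒≡ d c eq) (isConst⇒≡replicate c y e)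
isConst⇒≡replicate c (d ∷ y) () | false

isConst-replicate : ∀ m c → isConst c (replicate m c) ≡ true
isConst-replicate zero c = refl
isConst-replicate (suc m) c rewrite ==-refl c = isConst-replicate m c

isConst-replicate-≢ : ∀ m c d → c ≢ d → isConst c (replicate (suc m) d) ≡ false
isConst-replicate-≢ m c d c≢d rewrite ≢⇒==-false d c (≢-sym c≢d) = refl

Σ₃-drop : ∀ d g → Σ₃ (λ b → if d == b then 0ℚ else g b) ≡ Σ₃ g - g d
Σ₃-drop 𝟎 g = regroup (g 𝟎) (g 𝟏) (g 𝟐)
  where regroup : ∀ a b c → 0ℚ + (b + (c + 0ℚ)) ≡ (a + (b + (c + 0ℚ))) - a
        regroup = solve-∀ ℚ-ring
Σ₃-drop 𝟏 g = regroup (g 𝟎) (g 𝟏) (g 𝟐)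
  where regroup : ∀ a b c → a + (0ℚ + (c + 0ℚ)) ≡ (a + (b + (c + 0ℚ))) - b
        regroup = solve-∀ ℚ-ring
Σ₃-drop 𝟐 g = regroup (g 𝟎) (g 𝟏) (g 𝟐)
  where regroup : ∀ a b c → a + (b + (0ℚ + 0ℚ)) ≡ (a + (b + (c + 0ℚ))) - c
        regroup = solve-∀ ℚ-ring

Σ₃-pair : ∀ (g : Letter → ℚ) a a′ → a ≢ a′ → (∀ j → j ≢ a → j ≢ a′ → g j ≡ 0ℚ) → Σ₃ g ≡ g a + g a′
Σ₃-pair g 𝟎 𝟎 a≢a′ _ = ⊥-elim (a≢a′ refl)
Σ₃-pair g 𝟏 𝟏 a≢a′ _ = ⊥-elim (a≢a′ refl)
Σ₃-pair g 𝟐 𝟐 a≢a′ _ = ⊥-elim (a≢a′ refl)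
Σ₃-pair g 𝟎 𝟏 _ third rewrite third 𝟐 (λ ()) (λ ()) = regroup (g 𝟎) (g 𝟏)
  where regroup : ∀ a b → a + (b + (0ℚ + 0ℚ)) ≡ a + b
        regroup = solve-∀ ℚ-ring
Σ₃-pair g 𝟎 𝟐 _ third rewrite third 𝟏 (λ ()) (λ ()) = regroup (g 𝟎) (g 𝟐)
  where regroup : ∀ a b → a + (0ℚ + (b + 0ℚ)) ≡ a + b
        regroup = solve-∀ ℚ-ring
Σ₃-pair g 𝟏 𝟎 _ third rewrite third 𝟐 (λ ()) (λ ()) = regroup (g 𝟎) (g 𝟏)
  where regroup : ∀ a b → a + (b + (0ℚ + 0ℚ)) ≡ b + a
        regroup = solve-∀ ℚ-ring
Σ₃-pair g 𝟏 𝟐 _ third rewrite third 𝟎 (λ ()) (λ ()) = regroup (g 𝟏) (g 𝟐)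
  where regroup : ∀ a b → 0ℚ + (a + (b + 0ℚ)) ≡ a + b
        regroup = solve-∀ ℚ-ring
Σ₃-pair g 𝟐 𝟎 _ third rewrite third 𝟏 (λ ()) (λ ()) = regroup (g 𝟎) (g 𝟐)
  where regroup : ∀ a b → a + (0ℚ + (b + 0ℚ)) ≡ b + a
        regroup = solve-∀ ℚ-ring
Σ₃-pair g 𝟐 𝟏 _ third rewrite third 𝟎 (λ ()) (λ ()) = regroup (g 𝟏) (g 𝟐)
  where regroup : ∀ a b → 0ℚ + (a + (b + 0ℚ)) ≡ b + a
        regroup = solve-∀ ℚ-ring

Σ₃-corner : ∀ c (X : Letter → ℚ) G → X c ≡ G → Σ₃ (λ e → if e == c then 0ℚ else X e - G) ≡ Σ₃ X - (1ℚ + 1ℚ + 1ℚ) * G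
Σ₃-corner 𝟎 X G refl = regroup (X 𝟎) (X 𝟏) (X 𝟐)
  where regroup : ∀ a b c → 0ℚ + ((b - a) + ((c - a) + 0ℚ)) ≡ (a + (b + (c + 0ℚ))) - (1ℚ + 1ℚ + 1ℚ) * a
        regroup = solve-∀ ℚ-ring
Σ₃-corner 𝟏 X G refl = regroup (X 𝟎) (X 𝟏) (X 𝟐)
  where regroup : ∀ a b c → (a - b) + (0ℚ + ((c - b) + 0ℚ)) ≡ (a + (b + (c + 0ℚ))) - (1ℚ + 1ℚ + 1ℚ) * b
        regroup = solve-∀ ℚ-ring
Σ₃-corner 𝟐 X G refl = regroup (X 𝟎) (X 𝟏) (X 𝟐)
  where regroup : ∀ a b c → (a - c) + ((b - c) + (0ℚ + 0ℚ)) ≡ (a + (b + (c + 0ℚ))) - (1ℚ + 1ℚ + 1ℚ) * c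
        regroup = solve-∀ ℚ-ring

-- The Laplacian and its recursion over the first letter

if-true : ∀ {A : Set} {b} {X Y : A} → b ≡ true → (if b then X else Y) ≡ X
if-true refl = refl

if-false : ∀ {A : Set} {b} {X Y : A} → b ≡ false → (if b then X else Y) ≡ Y
if-false refl = refl

if-cong : ∀ {A : Set} b {X X′ Y Y′ : A} → (b ≡ true → X ≡ X′) → (b ≡ false → Y ≡ Y′) →
          (if b then X else Y) ≡ (if b then X′ else Y′)
if-cong true  t f = t refl
if-cong false t f = f refl

if-dec-yes : ∀ {P : Set} (d : Dec P) {X Y : ℚ} → P → (if ⌊ d ⌋ then X else Y) ≡ X
if-dec-yes (yes _) p = refl
if-dec-yes (no ¬p) p = ⊥-elim (¬p p)

if-dec-no : ∀ {P : Set} (d : Dec P) {X Y : ℚ} → ¬ P → (if ⌊ d ⌋ then X else Y) ≡ Y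
if-dec-no (yes p) ¬p = ⊥-elim (¬p p)
if-dec-no (no _)  ¬p = refl

if-dec-⇔ : ∀ {P Q : Set} (d₁ : Dec P) (d₂ : Dec Q) {X Y : ℚ} → (P → Q) → (Q → P) →
           (if ⌊ d₁ ⌋ then X else Y) ≡ (if ⌊ d₂ ⌋ then X else Y)
if-dec-⇔ (yes p) (yes q) to from = refl
if-dec-⇔ (yes p) (no ¬q) to from = ⊥-elim (¬q (to p))
if-dec-⇔ (no ¬p) (yes q) to from = ⊥-elim (¬p (from q))
if-dec-⇔ (no ¬p) (no ¬q) to from = refl

if-x-x : ∀ b q → (if b then q - q else 0ℚ) ≡ 0ℚ
if-x-x true  q = ℚP.+-inverseʳ q
if-x-x false q = refl

edgeTerm : ∀ {n} → (Word n → ℚ) → Word n → Word n → ℚ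
edgeTerm f x y = if ⌊ HEdge? x y ⌋ then f y - f x else 0ℚ

-- Lap n = 3 ΔH n, definitionally.
Lap : (n : ℕ) → (Word n → ℚ) → Word n → ℚ
Lap n f x = sumℚ (map (edgeTerm f x) (allWords n))

HEdge⇒share : ∀ {n} {x y : Word n} → HEdge x y → x ≢ y → ShareJNeighbour x y
HEdge⇒share (inj₁ (_ , s)) _   = s
HEdge⇒share (inj₂ (e , _)) x≢y = ⊥-elim (x≢y e)

HEdge-sym : ∀ {n} {x y : Word n} → HEdge x y → HEdge y x
HEdge-sym (inj₁ (x≢y , s))   = inj₁ (≢-sym x≢y , share-sym s)
HEdge-sym (inj₂ (refl , c)) = inj₂ (refl , c)

∷-≢ˡ : ∀ {n} {a b : Letter} {y z : Word n} → a ≢ b → (a ∷ y) ≢ (b ∷ z)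
∷-≢ˡ a≢b e = a≢b (VecP.∷-injectiveˡ e)

HEdge-∷⇔ : ∀ {n} a {y z : Word n} → y ≢ z → (HEdge (a ∷ y) (a ∷ z) ⇔ HEdge y z)
HEdge-∷⇔ a y≢z = mk⇔
  (λ h → inj₁ (y≢z , share-∷⁻ a (HEdge⇒share h (λ e → y≢z (VecP.∷-injectiveʳ e)))))
  (λ h → inj₁ ((λ e → y≢z (VecP.∷-injectiveʳ e)) , share-∷ a (HEdge⇒share h y≢z)))

edgeTerm-∷ : ∀ {n} f a (y z : Word n) → edgeTerm f (a ∷ y) (a ∷ z) ≡ edgeTerm (λ w → f (a ∷ w)) y z
edgeTerm-∷ f a y z = by-cases (z ≟W y)
  where
  by-cases : Dec (z ≡ y) → edgeTerm f (a ∷ y) (a ∷ z) ≡ edgeTerm (λ w → f (a ∷ w)) y z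
  by-cases (yes refl) = trans (if-x-x _ (f (a ∷ y))) (sym (if-x-x _ (f (a ∷ y))))
  by-cases (no z≢y)   = if-dec-⇔ (HEdge? (a ∷ y) (a ∷ z)) (HEdge? y z) (Equivalence.to iff) (Equivalence.from iff)
    where iff = HEdge-∷⇔ a (≢-sym z≢y)

-- Across sub-copies the only edge is the junction a jⁿ — j aⁿ.
sum-edgeTerm-across : ∀ {n} f {a j} (y : Word n) → j ≢ a →
  sumℚ (map (λ z → edgeTerm f (a ∷ y) (j ∷ z)) (allWords n))
    ≡ (if isConst j y then f (j ∷ replicate n a) - f (a ∷ y) else 0ℚ)
sum-edgeTerm-across {n} f {a} {j} y j≢a = by-cases (isConst j y) refl
  where
  a≢j = ≢-sym j≢a
  by-cases : ∀ b → isConst j y ≡ b →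
    sumℚ (map (λ z → edgeTerm f (a ∷ y) (j ∷ z)) (allWords n)) ≡ (if b then f (j ∷ replicate n a) - f (a ∷ y) else 0ℚ)
  by-cases true const = trans (sum-allWords-single n _ (replicate n a) off) (if-dec-yes (HEdge? _ _) junction)
    where
    off : ∀ z → z ≢ replicate n a → edgeTerm f (a ∷ y) (j ∷ z) ≡ 0ℚ
    off z z≢aⁿ = if-dec-no (HEdge? _ _)
      (λ h → z≢aⁿ (proj₂ (share-junction⁻ a j y z a≢j (HEdge⇒share h (∷-≢ˡ a≢j)))))
    junction : HEdge (a ∷ y) (j ∷ replicate n a)
    junction = inj₁ (∷-≢ˡ a≢j ,
      subst (λ w → ShareJNeighbour (a ∷ w) (j ∷ replicate n a)) (sym (isConst⇒≡replicate j y const)) (share-junction n a j))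
  by-cases false nonConst = sumℚ-zero (allWords n) (λ z → if-dec-no (HEdge? _ _)
    (λ h → y≢jⁿ (proj₁ (share-junction⁻ a j y z a≢j (HEdge⇒share h (∷-≢ˡ a≢j))))))
    where
    y≢jⁿ : y ≢ replicate n j
    y≢jⁿ y≡jⁿ with trans (sym (isConst-replicate n j)) (trans (cong (isConst j) (sym y≡jⁿ)) nonConst)
    ... | ()

lapTerm : (n : ℕ) → (Word (suc n) → ℚ) → Letter → Word n → Letter → ℚ
lapTerm n f a y j =
  if j == a then Lap n (λ z → f (j ∷ z)) y
  else (if isConst j y then f (j ∷ replicate n a) - f (a ∷ y) else 0ℚ)

lapTerm-same : ∀ n f a y → lapTerm n f a y a ≡ Lap n (λ z → f (a ∷ z)) y
lapTerm-same n f a y = if-true (==-refl a)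

lapTerm-across : ∀ n f a y j → j ≢ a →
  lapTerm n f a y j ≡ (if isConst j y then f (j ∷ replicate n a) - f (a ∷ y) else 0ℚ)
lapTerm-across n f a y j j≢a = if-false (≢⇒==-false j a j≢a)

Lap-∷ : ∀ n f a y → Lap (suc n) f (a ∷ y) ≡ Σ₃ (lapTerm n f a y)
Lap-∷ n f a y = trans (sum-allWords-suc n _) (Σ₃-cong block)
  where
  block : ∀ j → sumℚ (map (λ z → edgeTerm f (a ∷ y) (j ∷ z)) (allWords n)) ≡ lapTerm n f a y j
  block j = by-cases (j ≟L a)
    where
    by-cases : Dec (j ≡ a) → sumℚ (map (λ z → edgeTerm f (a ∷ y) (j ∷ z)) (allWords n)) ≡ lapTerm n f a y j
    by-cases (yes refl) = trans (sumℚ-cong (allWords n) (edgeTerm-∷ f a y)) (sym (lapTerm-same n f a y))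
    by-cases (no j≢a)   = trans (sum-edgeTerm-across f y j≢a) (sym (lapTerm-across n f a y j j≢a))

if0-cong : ∀ b {X X′ : ℚ} → X ≡ X′ → (if b then X else 0ℚ) ≡ (if b then X′ else 0ℚ)
if0-cong b = cong (λ q → if b then q else 0ℚ)

Lap-cong : ∀ n {f g : Word n → ℚ} x → (∀ z → f z ≡ g z) → Lap n f x ≡ Lap n g x
Lap-cong n x e = sumℚ-cong (allWords n) (λ y → if0-cong _ (cong₂ _-_ (e y) (e x)))

Lap-zero : ∀ n x → Lap n (λ _ → 0ℚ) x ≡ 0ℚ
Lap-zero n x = sumℚ-zero (allWords n) (λ y → if-x-x _ 0ℚ)

Lap-if-zero : ∀ n b (g : Word n → ℚ) x → Lap n (λ z → if b then 0ℚ else g z) x ≡ (if b then 0ℚ else Lap n g x)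
Lap-if-zero n true  g x = Lap-zero n x
Lap-if-zero n false g x = refl

Lap-if : ∀ n b (g : Word n → ℚ) x → Lap n (λ z → if b then g z else 0ℚ) x ≡ (if b then Lap n g x else 0ℚ)
Lap-if n true  g x = refl
Lap-if n false g x = Lap-zero n x

Lap-scale : ∀ n k (g : Word n → ℚ) x → Lap n (λ z → k * g z) x ≡ k * Lap n g x
Lap-scale n k g x = trans (sumℚ-cong (allWords n) term) (sumℚ-* k _ (allWords n))
  where
  distrib : ∀ k a b → k * a - k * b ≡ k * (a - b)
  distrib = solve-∀ ℚ-ring
  term : ∀ y → edgeTerm (λ z → k * g z) x y ≡ k * edgeTerm g x y
  term y with ⌊ HEdge? x y ⌋
  ... | true  = distrib k (g y) (g x)
  ... | false = sym (ℚP.*-zeroʳ k)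

Lap-0 : ∀ f → Lap 0 f [] ≡ 0ℚ
Lap-0 f = trans (ℚP.+-identityʳ _) (ℚP.+-inverseʳ (f []))

lapTerm-0 : ∀ f d j → lapTerm 0 f d [] j ≡ (if j == d then 0ℚ else f (j ∷ []) - f (d ∷ []))
lapTerm-0 f d j = if-cong (j == d) (λ _ → Lap-0 (λ z → f (j ∷ z))) (λ _ → refl)

-- Cycle functions are eigenfunctions

-- orientation a c is +1 or −1 according as c follows or precedes a in the cyclic order 𝟎 𝟏 𝟐.
orientation : Letter → Letter → ℚ
orientation 𝟎 𝟎 = 0ℚ
orientation 𝟎 𝟏 = 1ℚ
orientation 𝟎 𝟐 = - 1ℚ
orientation 𝟏 𝟎 = - 1ℚ
orientation 𝟏 𝟏 = 0ℚ
orientation 𝟏 𝟐 = 1ℚ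
orientation 𝟐 𝟎 = 1ℚ
orientation 𝟐 𝟏 = - 1ℚ
orientation 𝟐 𝟐 = 0ℚ

orientation-self : ∀ a → orientation a a ≡ 0ℚ
orientation-self 𝟎 = refl
orientation-self 𝟏 = refl
orientation-self 𝟐 = refl

arcFrom : Letter → Letter → List Letter → ℚ
arcFrom a c []      = orientation a c
arcFrom a c (d ∷ r) = if d == a then 0ℚ else arcFrom a d r

arcList : Letter → List Letter → ℚ
arcList a []      = 0ℚ
arcList a (c ∷ r) = if c == a then 0ℚ else arcFrom a c r

cycleList : List Letter → List Letter → ℚ
cycleList []      []      = 0ℚ
cycleList []      (j ∷ r) = arcList j r
cycleList (a ∷ u) []      = 0ℚ
cycleList (a ∷ u) (b ∷ r) = if a == b then cycleList u r else 0ℚ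

if-0-0 : ∀ b → (if b then 0ℚ else 0ℚ) ≡ 0ℚ
if-0-0 true  = refl
if-0-0 false = refl

arc : ∀ {m} → Letter → Word m → ℚ
arc a y = arcList a (toList y)

-- The alternating function of C_{u,k}: cycle u (u j r) is 0 unless r avoids j, and is then
-- orientation j (last letter of r); going once around the hole flips this sign at every step.
cycle : ∀ {m} → List Letter → Word m → ℚ
cycle u x = cycleList u (toList x)

arc-∷ : ∀ {m} a j (z : Word (suc m)) → arc a (j ∷ z) ≡ (if j == a then 0ℚ else arc a z)
arc-∷ a j (_ ∷ _) = refl

arcFrom-replicate : ∀ m a c → arcFrom a c (toList (replicate m c)) ≡ orientation a c
arcFrom-replicate zero    a c = refl
arcFrom-replicate (suc m) a c = by-cases (c ≟L a)
  where
  by-cases : Dec (c ≡ a) → (if c == a then 0ℚ else arcFrom a c (toList (replicate m c))) ≡ orientation a c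
  by-cases (yes refl) = trans (if-true (==-refl c)) (sym (orientation-self c))
  by-cases (no c≢a)   = trans (if-false (≢⇒==-false c a c≢a)) (arcFrom-replicate m a c)

arc-replicate : ∀ m a c → arc a (replicate (suc m) c) ≡ orientation a c
arc-replicate m = arcFrom-replicate (suc m)

cycle-replicate : ∀ u m c → cycleList u (toList (replicate m c)) ≡ 0ℚ
cycle-replicate []      zero          c = refl
cycle-replicate []      (suc zero)    c = refl
cycle-replicate []      (suc (suc m)) c = if-true (==-refl c)
cycle-replicate (b ∷ u) zero          c = refl
cycle-replicate (b ∷ u) (suc m)       c = trans (if-cong (b == c) (λ _ → cycle-replicate u m c) (λ _ → refl)) (if-0-0 (b == c))

isConst-replicate-== : ∀ m j c → isConst j (replicate (suc m) c) ≡ (c == j)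
isConst-replicate-== m j c = by-cases (c ≟L j)
  where
  by-cases : Dec (c ≡ j) → isConst j (replicate (suc m) c) ≡ (c == j)
  by-cases (yes refl) = trans (isConst-replicate (suc m) c) (sym (==-refl c))
  by-cases (no c≢j)   = trans (isConst-replicate-≢ m j c (≢-sym c≢j)) (sym (≢⇒==-false c j c≢j))

ConstView : ∀ {m} → Word (suc m) → Set
ConstView {m} y = (∃ λ c → y ≡ replicate (suc m) c) ⊎ (∀ c → isConst c y ≡ false)

constView : ∀ {m} (y : Word (suc m)) → ConstView y
constView {m} y = go (isConst 𝟎 y) refl (isConst 𝟏 y) refl (isConst 𝟐 y) refl
  where
  go : ∀ b₀ → isConst 𝟎 y ≡ b₀ → ∀ b₁ → isConst 𝟏 y ≡ b₁ → ∀ b₂ → isConst 𝟐 y ≡ b₂ → ConstView y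
  go true  e₀ _     _  _     _  = inj₁ (𝟎 , isConst⇒≡replicate 𝟎 y e₀)
  go false e₀ true  e₁ _     _  = inj₁ (𝟏 , isConst⇒≡replicate 𝟏 y e₁)
  go false e₀ false e₁ true  e₂ = inj₁ (𝟐 , isConst⇒≡replicate 𝟐 y e₂)
  go false e₀ false e₁ false e₂ = inj₂ λ { 𝟎 → e₀ ; 𝟏 → e₁ ; 𝟐 → e₂ }

nonConst-∷ : ∀ {n} a (y : Word n) → (∀ c → isConst c y ≡ false) → ∀ c → isConst c (a ∷ y) ≡ false
nonConst-∷ a y nonConst c = trans (cong ((a == c) ∧_) (nonConst c)) (∧-zeroʳ (a == c))

-5ℚ : ℚ
-5ℚ = - (ℤ.+ 5 Q./ 1)

2ℚ : ℚ
2ℚ = ℤ.+ 2 Q./ 1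

-- arc a fails to be a (−5)-eigenfunction of Lap only at the corners cᵐ (c ≠ a) of the copy.
arcDefect : ∀ {m} → Letter → Word m → ℚ
arcDefect a y = Σ₃ (λ c → if c == a then 0ℚ else (if isConst c y then 2ℚ * orientation a c else 0ℚ))

arcDefect-replicate : ∀ m a c →
  arcDefect a (replicate (suc m) c) ≡ Σ₃ (λ c′ → if c′ == a then 0ℚ else (if c == c′ then 2ℚ * orientation a c′ else 0ℚ))
arcDefect-replicate m a c =
  Σ₃-cong (λ c′ → cong (λ b → if c′ == a then 0ℚ else (if b then 2ℚ * orientation a c′ else 0ℚ)) (isConst-replicate-== m c′ c))

arcDefect-nonConst : ∀ {m} a (y : Word m) → (∀ c → isConst c y ≡ false) → arcDefect a y ≡ 0ℚ
arcDefect-nonConst a y nonConst =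
  Σ₃-cong {h = λ _ → 0ℚ} λ c →
    trans (cong (λ b → if c == a then 0ℚ else (if b then 2ℚ * orientation a c else 0ℚ)) (nonConst c)) (if-0-0 (c == a))

arcTerm : ∀ {m} → Letter → Letter → Word (suc m) → Letter → ℚ
arcTerm a d y j =
  if j == d then (if d == a then 0ℚ else -5ℚ * arc a y + arcDefect a y)
  else (if isConst j y then (if j == a then 0ℚ else orientation a d) - (if d == a then 0ℚ else arc a y) else 0ℚ)

lapTerm-arc : ∀ m a d (y : Word (suc m)) → Lap (suc m) (arc a) y ≡ -5ℚ * arc a y + arcDefect a y →
              ∀ j → lapTerm (suc m) (arc a) d y j ≡ arcTerm a d y j
lapTerm-arc m a d y IH j = if-cong (j == d)
  (λ j==d → subst (λ j′ → Lap (suc m) (λ z → arc a (j′ ∷ z)) y ≡ (if d == a then 0ℚ else -5ℚ * arc a y + arcDefect a y))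
                  (sym (==⇒≡ j d j==d))
                  (trans (Lap-cong (suc m) y (arc-∷ a d))
                  (trans (Lap-if-zero (suc m) (d == a) (arc a) y) (cong (λ q → if d == a then 0ℚ else q) IH))))
  (λ _ → if0-cong (isConst j y)
           (cong₂ _-_ (trans (arc-∷ a j (replicate (suc m) d)) (cong (λ q → if j == a then 0ℚ else q) (arc-replicate m a d)))
                      (arc-∷ a d y)))

Σ₃-arcTerm-junction : ∀ a d c →
  Σ₃ (λ j → if j == d then (if d == a then 0ℚ else -5ℚ * orientation a c
                              + Σ₃ (λ c′ → if c′ == a then 0ℚ else (if c == c′ then 2ℚ * orientation a c′ else 0ℚ)))
            else (if c == j then (if j == a then 0ℚ else orientation a d) - (if d == a then 0ℚ else orientation a c) else 0ℚ))
  ≡ -5ℚ * (if d == a then 0ℚ else orientation a c)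
    + Σ₃ (λ c′ → if c′ == a then 0ℚ else (if (d == c′) ∧ (c == c′) then 2ℚ * orientation a c′ else 0ℚ))
Σ₃-arcTerm-junction = by-evaluation₃

Lap-arc-1 : ∀ a d →
  Σ₃ (λ j → if j == d then 0ℚ else arc a (j ∷ []) - arc a (d ∷ [])) ≡ -5ℚ * arc a (d ∷ []) + arcDefect a (d ∷ [])
Lap-arc-1 = by-evaluation₂

arcDefect-junction : ∀ m a d c → arcDefect a (d ∷ replicate (suc m) c)
  ≡ Σ₃ (λ c′ → if c′ == a then 0ℚ else (if (d == c′) ∧ (c == c′) then 2ℚ * orientation a c′ else 0ℚ))
arcDefect-junction m a d c = Σ₃-cong λ c′ →
  cong (λ b → if c′ == a then 0ℚ else (if (d == c′) ∧ b then 2ℚ * orientation a c′ else 0ℚ)) (isConst-replicate-== m c′ c)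

arc-∷-replicate : ∀ m a d c → arc a (d ∷ replicate (suc m) c) ≡ (if d == a then 0ℚ else orientation a c)
arc-∷-replicate m a d c = trans (arc-∷ a d (replicate (suc m) c)) (cong (λ q → if d == a then 0ℚ else q) (arc-replicate m a c))

Σ₃-arcTerm : ∀ m a d (y : Word (suc m)) → Σ₃ (arcTerm a d y) ≡ -5ℚ * arc a (d ∷ y) + arcDefect a (d ∷ y)
Σ₃-arcTerm m a d y = by-cases (constView y)
  where
  by-cases : ConstView y → Σ₃ (arcTerm a d y) ≡ -5ℚ * arc a (d ∷ y) + arcDefect a (d ∷ y)
  by-cases (inj₁ (c , refl)) =
    trans (Σ₃-cong term)
    (trans (Σ₃-arcTerm-junction a d c)
           (sym (cong₂ _+_ (cong (-5ℚ *_) (arc-∷-replicate m a d c)) (arcDefect-junction m a d c))))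
    where
    term : ∀ j → arcTerm a d (replicate (suc m) c) j ≡ _
    term j = if-cong (j == d)
      (λ _ → cong (λ q → if d == a then 0ℚ else q)
                  (cong₂ _+_ (cong (-5ℚ *_) (arc-replicate m a c)) (arcDefect-replicate m a c)))
      (λ _ → trans (cong (λ b → if b then (if j == a then 0ℚ else orientation a d)
                                          - (if d == a then 0ℚ else arc a (replicate (suc m) c)) else 0ℚ)
                         (isConst-replicate-== m j c))
                   (if0-cong (c == j) (cong (λ q → (if j == a then 0ℚ else orientation a d) - (if d == a then 0ℚ else q))
                                            (arc-replicate m a c))))
  by-cases (inj₂ nonConst) =
    trans (Σ₃-single (arcTerm a d y) d off)
    (trans (if-true (==-refl d))
    (trans (cong (λ q → if d == a then 0ℚ else -5ℚ * arc a y + q) (arcDefect-nonConst a y nonConst))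
    (trans (pull-out (d == a) (arc a y))
           (sym (cong₂ _+_ (cong (-5ℚ *_) (arc-∷ a d y)) (arcDefect-nonConst a (d ∷ y) (nonConst-∷ d y nonConst)))))))
    where
    off : ∀ j → j ≢ d → arcTerm a d y j ≡ 0ℚ
    off j j≢d = trans (if-false (≢⇒==-false j d j≢d)) (if-false (nonConst j))
    pull-out : ∀ b X → (if b then 0ℚ else -5ℚ * X + 0ℚ) ≡ -5ℚ * (if b then 0ℚ else X) + 0ℚ
    pull-out true  X = refl
    pull-out false X = refl

Lap-arc : ∀ m a (y : Word (suc m)) → Lap (suc m) (arc a) y ≡ -5ℚ * arc a y + arcDefect a y
Lap-arc zero a (d ∷ []) =
  trans (Lap-∷ 0 (arc a) d []) (trans (Σ₃-cong (lapTerm-0 (arc a) d)) (Lap-arc-1 a d))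
Lap-arc (suc m) a (d ∷ y) = begin
  Lap (suc (suc m)) (arc a) (d ∷ y)               ≡⟨ Lap-∷ (suc m) (arc a) d y ⟩
  Σ₃ (lapTerm (suc m) (arc a) d y)                ≡⟨ Σ₃-cong (lapTerm-arc m a d y (Lap-arc m a y)) ⟩
  Σ₃ (arcTerm a d y)                              ≡⟨ Σ₃-arcTerm m a d y ⟩
  -5ℚ * arc a (d ∷ y) + arcDefect a (d ∷ y)      ∎
  where open ≡-Reasoning

-- At a corner cᵐ of copy a, the defect of arc a is cancelled by the junction edge to copy c.
Σ₃-cycleTerm-corner : ∀ a c →
  Σ₃ (λ j → if j == a then -5ℚ * orientation a c
                             + Σ₃ (λ c′ → if c′ == a then 0ℚ else (if c == c′ then 2ℚ * orientation a c′ else 0ℚ))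
            else (if c == j then orientation j a - orientation a c else 0ℚ))
  ≡ -5ℚ * orientation a c
Σ₃-cycleTerm-corner = by-evaluation₂

Lap-cycle-top : ∀ m (x : Word (suc (suc m))) → Lap (suc (suc m)) (cycle []) x ≡ -5ℚ * cycle [] x
Lap-cycle-top m (a ∷ y) = trans (Lap-∷ (suc m) (cycle []) a y) (trans (Σ₃-cong term) (by-cases (constView y)))
  where
  topTerm : Letter → ℚ
  topTerm j = if j == a then -5ℚ * arc a y + arcDefect a y
              else (if isConst j y then arc j (replicate (suc m) a) - arc a y else 0ℚ)
  term : ∀ j → lapTerm (suc m) (cycle []) a y j ≡ topTerm j
  term j = if-cong (j == a)
    (λ j==a → subst (λ j′ → Lap (suc m) (arc j′) y ≡ -5ℚ * arc a y + arcDefect a y) (sym (==⇒≡ j a j==a)) (Lap-arc m a y))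
    (λ _ → refl)
  by-cases : ConstView y → Σ₃ topTerm ≡ -5ℚ * arc a y
  by-cases (inj₁ (c , refl)) =
    trans (Σ₃-cong corner) (trans (Σ₃-cycleTerm-corner a c) (cong (-5ℚ *_) (sym (arc-replicate m a c))))
    where
    corner : ∀ j → topTerm j ≡ _
    corner j = if-cong (j == a)
      (λ _ → cong₂ _+_ (cong (-5ℚ *_) (arc-replicate m a c)) (arcDefect-replicate m a c))
      (λ _ → trans (cong (λ b → if b then arc j (replicate (suc m) a) - arc a (replicate (suc m) c) else 0ℚ)
                         (isConst-replicate-== m j c))
                   (if0-cong (c == j) (cong₂ _-_ (arc-replicate m j a) (arc-replicate m a c))))
  by-cases (inj₂ nonConst) =
    trans (Σ₃-single topTerm a off)
    (trans (if-true (==-refl a)) (trans (cong (-5ℚ * arc a y +_) (arcDefect-nonConst a y nonConst)) (ℚP.+-identityʳ _)))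
    where
    off : ∀ j → j ≢ a → topTerm j ≡ 0ℚ
    off j j≢a = trans (if-false (≢⇒==-false j a j≢a)) (if-false (nonConst j))

Lap-cycle-∷ : ∀ m b u → (∀ y → Lap (suc m) (cycle u) y ≡ -5ℚ * cycle u y) →
              ∀ x → Lap (suc (suc m)) (cycle (b ∷ u)) x ≡ -5ℚ * cycle (b ∷ u) x
Lap-cycle-∷ m b u IH (a ∷ y) =
  trans (Lap-∷ (suc m) (cycle (b ∷ u)) a y)
  (trans (Σ₃-single (lapTerm (suc m) (cycle (b ∷ u)) a y) a across)
  (trans (lapTerm-same (suc m) (cycle (b ∷ u)) a y)
  (trans (Lap-if (suc m) (b == a) (cycle u) y)
  (trans (cong (λ q → if b == a then q else 0ℚ) (IH y)) (pull-out (b == a))))))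
  where
  vanish : ∀ {k} bb c → (if bb then cycleList u (toList (replicate k c)) else 0ℚ) ≡ 0ℚ
  vanish true  c = cycle-replicate u _ c
  vanish false c = refl
  -- a junction endpoint j aᵐ⁺¹ or a jᵐ⁺¹ lies on no cycle inside copy b
  junction : ∀ j bb → isConst j y ≡ bb →
    (if bb then cycle (b ∷ u) (j ∷ replicate (suc m) a) - cycle (b ∷ u) (a ∷ y) else 0ℚ) ≡ 0ℚ
  junction j true  const = cong₂ _-_ (vanish (b == j) a)
    (trans (cong (λ w → cycle (b ∷ u) (a ∷ w)) (isConst⇒≡replicate j y const)) (vanish (b == a) j))
  junction j false _ = refl
  across : ∀ j → j ≢ a → lapTerm (suc m) (cycle (b ∷ u)) a y j ≡ 0ℚ
  across j j≢a = trans (lapTerm-across (suc m) (cycle (b ∷ u)) a y j j≢a) (junction j (isConst j y) refl)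
  pull-out : ∀ bb → (if bb then -5ℚ * cycle u y else 0ℚ) ≡ -5ℚ * (if bb then cycle u y else 0ℚ)
  pull-out true  = refl
  pull-out false = sym (ℚP.*-zeroʳ -5ℚ)

Lap-cycle : ∀ m (u : List Letter) → L.length u ℕ.+ 2 ℕ.≤ m → ∀ x → Lap m (cycle u) x ≡ -5ℚ * cycle u x
Lap-cycle (suc (suc m)) []      _           = Lap-cycle-top m
Lap-cycle (suc (suc m)) (b ∷ u) (ℕ.s≤s le) = Lap-cycle-∷ m b u (Lap-cycle (suc m) u le)
Lap-cycle (suc zero)    []      (ℕ.s≤s ())
Lap-cycle (suc zero)    (b ∷ u) (ℕ.s≤s le) with () ← ℕP.m+n≤o⇒n≤o (L.length u) le

-- Independence of the cycle functions

sumBasis : (n : ℕ) → Coeffs n → ℚ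
sumBasis n G = sumℚ (map (λ q → G (proj₁ q) (proj₂ q)) (basisIndices n))

sumAtScale : (n : ℕ) → Coeffs n → ℕ → ℚ
sumAtScale n G k = sumℚ (map (G k) (allWords (n ∸ k)))

sumBasis-byScale : ∀ n G → sumBasis n G ≡ sumℚ (map (λ i → sumAtScale n G (2 ℕ.+ i)) (upTo (n ∸ 1)))
sumBasis-byScale n G =
  trans (sumℚ-concatMap term (λ k → map (k ,_) (allWords (n ∸ k))) (scales n))
  (trans (sumℚ-map (λ k → sumℚ (map term (map (k ,_) (allWords (n ∸ k))))) (2 ℕ.+_) (upTo (n ∸ 1)))
         (sumℚ-cong (upTo (n ∸ 1)) λ i → sumℚ-map term (2 ℕ.+ i ,_) (allWords (n ∸ (2 ℕ.+ i)))))
  where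
  term : (Σ ℕ λ k → Word (n ∸ k)) → ℚ
  term q = G (proj₁ q) (proj₂ q)

sum-applyUpTo-cong : ∀ (f : ℕ → ℕ) N {g h : ℕ → ℚ} → (∀ i → i ℕ.< N → g (f i) ≡ h (f i)) →
                     sumℚ (map g (applyUpTo f N)) ≡ sumℚ (map h (applyUpTo f N))
sum-applyUpTo-cong f zero    e = refl
sum-applyUpTo-cong f (suc N) e = cong₂ _+_ (e 0 (ℕ.s≤s ℕ.z≤n)) (sum-applyUpTo-cong (f ∘ suc) N (λ i i<N → e (suc i) (ℕ.s≤s i<N)))

sumBasis-cong : ∀ n {G H : Coeffs n} → (∀ k u → 2 ℕ.≤ k → k ℕ.≤ n → G k u ≡ H k u) → sumBasis n G ≡ sumBasis n H
sumBasis-cong n {G} {H} e =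
  trans (sumBasis-byScale n G) (trans (sum-applyUpTo-cong (λ i → i) (n ∸ 1) scale) (sym (sumBasis-byScale n H)))
  where
  2+i≤n : ∀ {i n} → i ℕ.< n ∸ 1 → 2 ℕ.+ i ℕ.≤ n
  2+i≤n {n = suc n} i<n-1 = ℕ.s≤s i<n-1
  scale : ∀ i → i ℕ.< n ∸ 1 → sumAtScale n G (2 ℕ.+ i) ≡ sumAtScale n H (2 ℕ.+ i)
  scale i i<n-1 = sumℚ-cong (allWords (n ∸ (2 ℕ.+ i))) (λ u → e (2 ℕ.+ i) u (ℕ.s≤s (ℕ.s≤s ℕ.z≤n)) (2+i≤n i<n-1))

sumBasis-zero : ∀ n {G : Coeffs n} → (∀ k u → 2 ℕ.≤ k → k ℕ.≤ n → G k u ≡ 0ℚ) → sumBasis n G ≡ 0ℚ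
sumBasis-zero n e = trans (sumBasis-cong n e) (sumℚ-zero (basisIndices n) (λ _ → refl))

sumBasis-+ : ∀ n (G H : Coeffs n) → sumBasis n (λ k u → G k u + H k u) ≡ sumBasis n G + sumBasis n H
sumBasis-+ n G H = sumℚ-+ _ _ (basisIndices n)

sumBasis-* : ∀ n c (G : Coeffs n) → sumBasis n (λ k u → c * G k u) ≡ c * sumBasis n G
sumBasis-* n c G = sumℚ-* c _ (basisIndices n)

sumBasis-if : ∀ n b (G : Coeffs n) → sumBasis n (λ k u → if b then G k u else 0ℚ) ≡ (if b then sumBasis n G else 0ℚ)
sumBasis-if n true  G = refl
sumBasis-if n false G = sumℚ-zero (basisIndices n) (λ _ → refl)

-- A basis index (k , u) of level m inside the copy a of level m + 1 becomes (k , a u).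
prepend : Letter → ∀ m k → Word (m ∸ k) → Word (suc m ∸ k)
prepend a m       zero          u = a ∷ u
prepend a zero    (suc zero)    u = u
prepend a zero    (suc (suc k)) u = u
prepend a (suc m) (suc k)       u = prepend a m k u

toList-prepend : ∀ a m k (u : Word (m ∸ k)) → k ℕ.≤ m → toList (prepend a m k u) ≡ a ∷ toList u
toList-prepend a m       zero    u _          = refl
toList-prepend a (suc m) (suc k) u (ℕ.s≤s k≤m) = toList-prepend a m k u k≤m

prepend-surjective : ∀ m k → k ℕ.≤ m → (u : Word (suc m ∸ k)) → ∃₂ λ a u′ → u ≡ prepend a m k u′
prepend-surjective m       zero    _          (a ∷ u) = a , u , refl
prepend-surjective (suc m) (suc k) (ℕ.s≤s k≤m) u      = prepend-surjective m k k≤m u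

emptyIndex : ∀ m → Word (m ∸ m)
emptyIndex zero    = []
emptyIndex (suc m) = emptyIndex m

emptyIndex-unique : ∀ m (u : Word (m ∸ m)) → u ≡ emptyIndex m
emptyIndex-unique zero    [] = refl
emptyIndex-unique (suc m) u  = emptyIndex-unique m u

toList-emptyIndex : ∀ m → toList (emptyIndex m) ≡ []
toList-emptyIndex zero    = refl
toList-emptyIndex (suc m) = toList-emptyIndex m

sum-emptyIndex : ∀ m (H : Word (m ∸ m) → ℚ) → sumℚ (map H (allWords (m ∸ m))) ≡ H (emptyIndex m)
sum-emptyIndex zero    H = ℚP.+-identityʳ _
sum-emptyIndex (suc m) H = sum-emptyIndex m H

sum-byFirstLetter : ∀ n k → k ℕ.≤ n → (H : Word (suc n ∸ k) → ℚ) →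
  sumℚ (map H (allWords (suc n ∸ k))) ≡ Σ₃ (λ a → sumℚ (map (λ u → H (prepend a n k u)) (allWords (n ∸ k))))
sum-byFirstLetter n       zero    _          H = sum-allWords-suc n H
sum-byFirstLetter (suc n) (suc k) (ℕ.s≤s k≤n) H = sum-byFirstLetter n k k≤n H

restrictCoeffs : Letter → ∀ m → Coeffs (suc m) → Coeffs m
restrictCoeffs a m G k u = G k (prepend a m k u)

sumBasis-suc : ∀ m (G : Coeffs (suc (suc m))) →
  sumBasis (suc (suc m)) G ≡ Σ₃ (λ a → sumBasis (suc m) (restrictCoeffs a (suc m) G)) + G (suc (suc m)) (emptyIndex m)
sumBasis-suc m G =
  trans (sumBasis-byScale (suc (suc m)) G)
  (trans (cong (λ l → sumℚ (map (λ i → sumAtScale (suc (suc m)) G (2 ℕ.+ i)) l)) (sym (LP.applyUpTo-∷ʳ (λ i → i) m)))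
  (trans (sumℚ-++ _ (upTo m) (m ∷ []))
  (cong₂ _+_
    (trans (sum-applyUpTo-cong (λ i → i) m lower)
    (trans (sumℚ-Σ₃ (λ i a → sumAtScale (suc m) (restrictCoeffs a (suc m) G) (2 ℕ.+ i)) (upTo m))
           (Σ₃-cong (λ a → sym (sumBasis-byScale (suc m) (restrictCoeffs a (suc m) G))))))
    (trans (ℚP.+-identityʳ _) (sum-emptyIndex m (G (suc (suc m))))))))
  where
  lower : ∀ i → i ℕ.< m → sumAtScale (suc (suc m)) G (2 ℕ.+ i)
                          ≡ Σ₃ (λ a → sumAtScale (suc m) (restrictCoeffs a (suc m) G) (2 ℕ.+ i))
  lower i i<m = sum-byFirstLetter (suc m) (2 ℕ.+ i) (ℕ.s≤s i<m) (G (2 ℕ.+ i))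

cycleFamily : ∀ n → Family n
cycleFamily n k u = cycle (toList u)

cycleComb : ∀ n → Coeffs n → Word n → ℚ
cycleComb n c = linComb n c (cycleFamily n)

cycleComb-∷ : ∀ m (c : Coeffs (suc (suc m))) a (y : Word (suc m)) →
  cycleComb (suc (suc m)) c (a ∷ y) ≡ cycleComb (suc m) (restrictCoeffs a (suc m) c) y + c (suc (suc m)) (emptyIndex m) * arc a y
cycleComb-∷ m c a y =
  trans (sumBasis-suc m _)
        (cong₂ _+_ inner (cong (λ l → c (suc (suc m)) (emptyIndex m) * cycleList l (a ∷ toList y)) (toList-emptyIndex m)))
  where
  c′ = restrictCoeffs a (suc m) c
  only-a : ∀ a′ k u → 2 ℕ.≤ k → k ℕ.≤ suc m →
    restrictCoeffs a′ (suc m) (λ k u → c k u * cycle (toList u) (a ∷ y)) k u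
      ≡ (if a′ == a then restrictCoeffs a′ (suc m) c k u * cycle (toList u) y else 0ℚ)
  only-a a′ k u _ k≤m = trans (cong (λ l → c k (prepend a′ (suc m) k u) * cycleList l (a ∷ toList y)) (toList-prepend a′ (suc m) k u k≤m))
                              (pull-in (a′ == a))
    where
    pull-in : ∀ b → c k (prepend a′ (suc m) k u) * (if b then cycle (toList u) y else 0ℚ)
                    ≡ (if b then c k (prepend a′ (suc m) k u) * cycle (toList u) y else 0ℚ)
    pull-in true  = refl
    pull-in false = ℚP.*-zeroʳ (c k (prepend a′ (suc m) k u))
  inner : Σ₃ (λ a′ → sumBasis (suc m) (restrictCoeffs a′ (suc m) (λ k u → c k u * cycle (toList u) (a ∷ y))))
          ≡ cycleComb (suc m) c′ y
  inner = trans (Σ₃-cong (λ a′ → trans (sumBasis-cong (suc m) (only-a a′))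
                                       (sumBasis-if (suc m) (a′ == a) (λ k u → restrictCoeffs a′ (suc m) c k u * cycle (toList u) y))))
          (trans (Σ₃-single (λ a′ → if a′ == a then sumBasis (suc m) (λ k u → restrictCoeffs a′ (suc m) c k u * cycle (toList u) y) else 0ℚ)
                            a (λ a′ a′≢a → if-false (≢⇒==-false a′ a a′≢a)))
                 (if-true (==-refl a)))

Σ-arc≡-Σ-cycle : ∀ m (y : Word (suc m)) → Σ₃ (λ b → arc b y) ≡ - cycleComb (suc m) (λ _ _ → 1ℚ) y
Σ-arc≡-Σ-cycle zero (𝟎 ∷ []) = refl
Σ-arc≡-Σ-cycle zero (𝟏 ∷ []) = refl
Σ-arc≡-Σ-cycle zero (𝟐 ∷ []) = refl
Σ-arc≡-Σ-cycle (suc m) (d ∷ y) = begin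
  Σ₃ (λ b → arc b (d ∷ y))                       ≡⟨ Σ₃-cong (λ b → arc-∷ b d y) ⟩
  Σ₃ (λ b → if d == b then 0ℚ else arc b y)       ≡⟨ Σ₃-drop d (λ b → arc b y) ⟩
  Σ₃ (λ b → arc b y) - arc d y                    ≡⟨ cong (_- arc d y) (Σ-arc≡-Σ-cycle m y) ⟩
  - S - arc d y                                   ≡⟨ regroup S (arc d y) ⟩
  - (S + 1ℚ * arc d y)                            ≡⟨ cong -_ (sym (cycleComb-∷ m (λ _ _ → 1ℚ) d y)) ⟩
  - cycleComb (suc (suc m)) (λ _ _ → 1ℚ) (d ∷ y) ∎
  where
  open ≡-Reasoning
  S = cycleComb (suc m) (λ _ _ → 1ℚ) y
  regroup : ∀ S x → - S - x ≡ - (S + 1ℚ * x)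
  regroup = solve-∀ ℚ-ring

cycleComb-replicate : ∀ m (c : Coeffs (suc m)) a → cycleComb (suc m) c (replicate (suc m) a) ≡ 0ℚ
cycleComb-replicate m c a =
  sumBasis-zero (suc m) (λ k u _ _ → trans (cong (c k u *_) (cycle-replicate (toList u) (suc m) a)) (ℚP.*-zeroʳ (c k u)))

-- Only the top cycle is seen at the junction point 𝟎 𝟏ᵐ⁺¹, where it takes the value 1.
top-coefficient-zero : ∀ m (c : Coeffs (suc (suc m))) → (∀ x → cycleComb (suc (suc m)) c x ≡ 0ℚ) →
                       c (suc (suc m)) (emptyIndex m) ≡ 0ℚ
top-coefficient-zero m c vanish = begin
  top                                   ≡⟨ sym (ℚP.*-identityʳ top) ⟩
  top * 1ℚ                              ≡⟨ cong (top *_) (sym (arc-replicate m 𝟎 𝟏)) ⟩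
  top * arc 𝟎 x                         ≡⟨ sym (ℚP.+-identityˡ _) ⟩
  0ℚ + top * arc 𝟎 x                    ≡⟨ cong (_+ top * arc 𝟎 x) (sym (cycleComb-replicate m c₀ 𝟏)) ⟩
  cycleComb (suc m) c₀ x + top * arc 𝟎 x ≡⟨ sym (cycleComb-∷ m c 𝟎 x) ⟩
  cycleComb (suc (suc m)) c (𝟎 ∷ x)     ≡⟨ vanish (𝟎 ∷ x) ⟩
  0ℚ                                    ∎
  where
  open ≡-Reasoning
  top = c (suc (suc m)) (emptyIndex m)
  c₀ = restrictCoeffs 𝟎 (suc m) c
  x = replicate (suc m) 𝟏

restrictCoeffs-vanish : ∀ m (c : Coeffs (suc (suc m))) → (∀ x → cycleComb (suc (suc m)) c x ≡ 0ℚ) →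
                        ∀ a y → cycleComb (suc m) (restrictCoeffs a (suc m) c) y ≡ 0ℚ
restrictCoeffs-vanish m c vanish a y = begin
  cycleComb (suc m) (restrictCoeffs a (suc m) c) y               ≡⟨ sym (ℚP.+-identityʳ _) ⟩
  cycleComb (suc m) (restrictCoeffs a (suc m) c) y + 0ℚ          ≡⟨ cong (cycleComb (suc m) (restrictCoeffs a (suc m) c) y +_) (sym no-top) ⟩
  cycleComb (suc m) (restrictCoeffs a (suc m) c) y + top * arc a y ≡⟨ sym (cycleComb-∷ m c a y) ⟩
  cycleComb (suc (suc m)) c (a ∷ y)                              ≡⟨ vanish (a ∷ y) ⟩
  0ℚ                                                             ∎
  where
  open ≡-Reasoning
  top = c (suc (suc m)) (emptyIndex m)
  no-top : top * arc a y ≡ 0ℚ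
  no-top = trans (cong (_* arc a y) (top-coefficient-zero m c vanish)) (ℚP.*-zeroˡ (arc a y))

IndependentAt : ℕ → Set
IndependentAt m = ∀ (c : Coeffs m) → (∀ x → cycleComb m c x ≡ 0ℚ) → ∀ k → 2 ℕ.≤ k → k ℕ.≤ m → ∀ u → c k u ≡ 0ℚ

independentAt-suc : ∀ m → IndependentAt (suc m) → IndependentAt (suc (suc m))
independentAt-suc m IH c vanish k 2≤k k≤n u = by-cases (ℕP.m≤n⇒m<n∨m≡n k≤n)
  where
  by-cases : k ℕ.< suc (suc m) ⊎ k ≡ suc (suc m) → c k u ≡ 0ℚ
  by-cases (inj₂ refl)           = trans (cong (c k) (emptyIndex-unique m u)) (top-coefficient-zero m c vanish)
  by-cases (inj₁ (ℕ.s≤s k≤m+1)) = inside-copy (prepend-surjective (suc m) k k≤m+1 u)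
    where
    inside-copy : (∃₂ λ a u′ → u ≡ prepend a (suc m) k u′) → c k u ≡ 0ℚ
    inside-copy (a , u′ , refl) = IH (restrictCoeffs a (suc m) c) (restrictCoeffs-vanish m c vanish a) k 2≤k k≤m+1 u′

cycleComb-independent : ∀ m → IndependentAt m
cycleComb-independent zero          c vanish k (ℕ.s≤s _)         ()
cycleComb-independent (suc zero)    c vanish k (ℕ.s≤s (ℕ.s≤s _)) (ℕ.s≤s ())
cycleComb-independent (suc (suc m)) = independentAt-suc m (cycleComb-independent (suc m))

-- Lap is symmetric, hence its values sum to zero.
sum-Lap : ∀ n f → sumℚ (map (Lap n f) (allWords n)) ≡ 0ℚ
sum-Lap n f = begin
  sumℚ (map (Lap n f) W)                                               ≡⟨ sumℚ-cong W split-rows ⟩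
  sumℚ (map (λ x → sumℚ (map (into x) W) + - sumℚ (map (from x) W)) W) ≡⟨ sumℚ-+ _ _ W ⟩
  Σ² into + sumℚ (map (λ x → - sumℚ (map (from x) W)) W)               ≡⟨ cong₂ _+_ into≡from (sumℚ-neg _ W) ⟩
  Σ² from + - Σ² from                                                  ≡⟨ ℚP.+-inverseʳ (Σ² from) ⟩
  0ℚ                                                                   ∎
  where
  open ≡-Reasoning
  W = allWords n
  into from : Word n → Word n → ℚ
  into x y = if ⌊ HEdge? x y ⌋ then f y else 0ℚ
  from x y = if ⌊ HEdge? x y ⌋ then f x else 0ℚ
  Σ² : (Word n → Word n → ℚ) → ℚ
  Σ² g = sumℚ (map (λ x → sumℚ (map (g x) W)) W)
  split : ∀ b p q → (if b then p - q else 0ℚ) ≡ (if b then p else 0ℚ) + - (if b then q else 0ℚ)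
  split true  p q = refl
  split false p q = refl
  split-rows : ∀ x → Lap n f x ≡ sumℚ (map (into x) W) + - sumℚ (map (from x) W)
  split-rows x = trans (sumℚ-cong W (λ y → split (⌊ HEdge? x y ⌋) (f y) (f x)))
                       (trans (sumℚ-+ (into x) (λ y → - from x y) W) (cong (sumℚ (map (into x) W) +_) (sumℚ-neg (from x) W)))
  into≡from : Σ² into ≡ Σ² from
  into≡from = trans (sumℚ-swap into W W)
    (sumℚ-cong W (λ y → sumℚ-cong W (λ x → if-dec-⇔ (HEdge? x y) (HEdge? y x) HEdge-sym HEdge-sym)))

-- Eigenfunctions have vanishing triangle sums

triSum : ∀ {m} → (Word (suc m) → ℚ) → Word m → ℚ
triSum g w = Σ₃ (λ c → g (w ∷ʳ c))

EigenOffCorners : ∀ m → (Word m → ℚ) → Set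
EigenOffCorners m g = ∀ y → (∀ c → isConst c y ≡ false) → Lap m g y ≡ -5ℚ * g y

Lap-∷-nonConst : ∀ n g a (y : Word n) → (∀ c → isConst c y ≡ false) → Lap (suc n) g (a ∷ y) ≡ Lap n (λ z → g (a ∷ z)) y
Lap-∷-nonConst n g a y nonConst =
  trans (Lap-∷ n g a y)
  (trans (Σ₃-single (lapTerm n g a y) a (λ j j≢a → trans (lapTerm-across n g a y j j≢a) (if-false (nonConst j))))
         (lapTerm-same n g a y))

EigenOffCorners-∷ : ∀ n g a → EigenOffCorners (suc n) g → EigenOffCorners n (λ z → g (a ∷ z))
EigenOffCorners-∷ n g a eigen y nonConst =
  trans (sym (Lap-∷-nonConst n g a y nonConst)) (eigen (a ∷ y) (nonConst-∷ a y nonConst))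

replicate-∷ʳ : ∀ m (c : Letter) → replicate m c ∷ʳ c ≡ replicate (suc m) c
replicate-∷ʳ zero    c = refl
replicate-∷ʳ (suc m) c = cong (c ∷_) (replicate-∷ʳ m c)

Lap-corner : ∀ m g c → Lap (suc m) g (replicate (suc m) c)
                        ≡ Σ₃ (λ e → if e == c then 0ℚ else g (replicate m c ∷ʳ e) - g (replicate (suc m) c))
Lap-corner zero    g c = trans (Lap-∷ 0 g c []) (Σ₃-cong (λ e → lapTerm-0 g c e))
Lap-corner (suc m) g c =
  trans (Lap-∷ (suc m) g c (replicate (suc m) c))
  (trans (Σ₃-single (lapTerm (suc m) g c (replicate (suc m) c)) c
                    (λ j j≢c → trans (lapTerm-across (suc m) g c _ j j≢c) (if-false (isConst-replicate-≢ m j c j≢c))))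
  (trans (lapTerm-same (suc m) g c (replicate (suc m) c)) (Lap-corner m (λ z → g (c ∷ z)) c)))

3ℚ : ℚ
3ℚ = 1ℚ + 1ℚ + 1ℚ

Lap-corner-triSum : ∀ m g c → Lap (suc m) g (replicate (suc m) c) ≡ triSum g (replicate m c) - 3ℚ * g (replicate (suc m) c)
Lap-corner-triSum m g c =
  trans (Lap-corner m g c) (Σ₃-corner c (λ e → g (replicate m c ∷ʳ e)) (g (replicate (suc m) c)) (cong g (replicate-∷ʳ m c)))

Lap-junction : ∀ m g a a′ → a ≢ a′ →
  Lap (suc (suc m)) g (a ∷ replicate (suc m) a′)
    ≡ Lap (suc m) (λ z → g (a ∷ z)) (replicate (suc m) a′) + (g (a′ ∷ replicate (suc m) a) - g (a ∷ replicate (suc m) a′))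
Lap-junction m g a a′ a≢a′ =
  trans (Lap-∷ (suc m) g a (replicate (suc m) a′))
  (trans (Σ₃-pair (lapTerm (suc m) g a (replicate (suc m) a′)) a a′ a≢a′ third)
         (cong₂ _+_ (lapTerm-same (suc m) g a _)
                    (trans (lapTerm-across (suc m) g a _ a′ (≢-sym a≢a′)) (if-true (isConst-replicate (suc m) a′)))))
  where
  third : ∀ j → j ≢ a → j ≢ a′ → lapTerm (suc m) g a (replicate (suc m) a′) j ≡ 0ℚ
  third j j≢a j≢a′ = trans (lapTerm-across (suc m) g a _ j j≢a) (if-false (isConst-replicate-≢ m j a′ j≢a′))

junction-nonConst : ∀ m a a′ → a ≢ a′ → ∀ c → isConst c (a ∷ replicate (suc m) a′) ≡ false
junction-nonConst m a a′ a≢a′ c = trans (cong ((a == c) ∧_) (isConst-replicate-== m c a′)) (by-cases (a ≟L c))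
  where
  by-cases : Dec (a ≡ c) → ((a == c) ∧ (a′ == c)) ≡ false
  by-cases (yes refl) = cong₂ _∧_ (==-refl a) (≢⇒==-false a′ a (≢-sym a≢a′))
  by-cases (no a≢c)   = cong (_∧ (a′ == c)) (≢⇒==-false a c a≢c)

-- The eigenvalue equation at the junction vertex a a′ᵐ⁺¹, whose neighbours are the two other
-- vertices of its smallest triangle and the junction partner a′ aᵐ⁺¹.
junction-identity : ∀ m g a a′ → a ≢ a′ → EigenOffCorners (suc (suc m)) g →
  triSum (λ z → g (a ∷ z)) (replicate m a′) + g (a ∷ replicate (suc m) a′) + g (a′ ∷ replicate (suc m) a) ≡ 0ℚ
junction-identity m g a a′ a≢a′ eigen = rearrange t G G′
  (trans (sym (trans (Lap-junction m g a a′ a≢a′) (cong (_+ (G′ - G)) (Lap-corner-triSum m (λ z → g (a ∷ z)) a′))))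
         (eigen (a ∷ replicate (suc m) a′) (junction-nonConst m a a′ a≢a′)))
  where
  t = triSum (λ z → g (a ∷ z)) (replicate m a′)
  G = g (a ∷ replicate (suc m) a′)
  G′ = g (a′ ∷ replicate (suc m) a)
  rearrange : ∀ t G G′ → (t - 3ℚ * G) + (G′ - G) ≡ -5ℚ * G → t + G + G′ ≡ 0ℚ
  rearrange t G G′ e = trans (expand t G G′) (trans (cong (_- -5ℚ * G) e) (ℚP.+-inverseʳ (-5ℚ * G)))
    where
    expand : ∀ t G G′ → t + G + G′ ≡ ((t - 3ℚ * G) + (G′ - G)) - -5ℚ * G
    expand = solve-∀ ℚ-ring

triSum-constant : ∀ m g → EigenOffCorners (suc m) g → ∀ w w′ → triSum g w ≡ triSum g w′
triSum-constant zero    g eigen [] [] = refl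
triSum-constant (suc m) g eigen (a ∷ v) (a′ ∷ v′) = by-cases (a ≟L a′)
  where
  IH : ∀ b → ∀ w w′ → triSum (λ z → g (b ∷ z)) w ≡ triSum (λ z → g (b ∷ z)) w′
  IH b = triSum-constant m (λ z → g (b ∷ z)) (EigenOffCorners-∷ (suc m) g b eigen)
  cancel : ∀ x y G G′ → x + G + G′ ≡ 0ℚ → y + G′ + G ≡ 0ℚ → x ≡ y
  cancel x y G G′ e₁ e₂ = trans (isolate-x x G G′) (trans (cong (_- (G + G′)) (trans e₁ (sym e₂))) (isolate-y y G G′))
    where
    isolate-x : ∀ x G G′ → x ≡ (x + G + G′) - (G + G′)
    isolate-x = solve-∀ ℚ-ring
    isolate-y : ∀ y G G′ → (y + G′ + G) - (G + G′) ≡ y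
    isolate-y = solve-∀ ℚ-ring
  by-cases : Dec (a ≡ a′) → triSum g (a ∷ v) ≡ triSum g (a′ ∷ v′)
  by-cases (yes refl) = IH a v v′
  by-cases (no a≢a′)  =
    trans (IH a v (replicate m a′))
    (trans (cancel _ _ _ _ (junction-identity m g a a′ a≢a′ eigen) (junction-identity m g a′ a (≢-sym a≢a′) eigen))
           (IH a′ (replicate m a) v′))

sum-triSum : ∀ m (f : Word (suc m) → ℚ) → sumℚ (map f (allWords (suc m))) ≡ sumℚ (map (triSum f) (allWords m))
sum-triSum zero    f =
  trans (sum-allWords-suc 0 f) (trans (Σ₃-cong (λ a → ℚP.+-identityʳ (f (a ∷ [])))) (sym (ℚP.+-identityʳ _)))
sum-triSum (suc m) f =
  trans (sum-allWords-suc (suc m) f)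
        (trans (Σ₃-cong (λ a → sum-triSum m (λ z → f (a ∷ z)))) (sym (sum-allWords-suc m (triSum f))))

sum-const-zero : ∀ m t → sumℚ (map (λ _ → t) (allWords m)) ≡ 0ℚ → t ≡ 0ℚ
sum-const-zero zero    t e = trans (sym (ℚP.+-identityʳ t)) e
sum-const-zero (suc m) t e =
  sum-const-zero m t (trans (thirds S) (trans (cong (⅓ *_) (trans (sym (sum-allWords-suc m (λ _ → t))) e)) (ℚP.*-zeroʳ ⅓)))
  where
  ⅓ = ℤ.+ 1 Q./ 3
  S = sumℚ (map (λ _ → t) (allWords m))
  thirds : ∀ S → S ≡ ⅓ * (S + (S + (S + 0ℚ)))
  thirds = solve-∀ ℚ-ring

triSum-zero : ∀ m (f : Word (suc (suc m)) → ℚ) → (∀ x → Lap (suc (suc m)) f x ≡ -5ℚ * f x) → ∀ w → triSum f w ≡ 0ℚ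
triSum-zero m f eigen w = trans (triSum-constant (suc m) f (λ y _ → eigen y) w w₀) triSum-w₀
  where
  W = allWords (suc (suc m))
  w₀ = replicate (suc m) 𝟎
  -⅕ = - (ℤ.+ 1 Q./ 5)
  sum-f : sumℚ (map f W) ≡ 0ℚ
  sum-f = begin
    sumℚ (map f W)                        ≡⟨ fifths (sumℚ (map f W)) ⟩
    -⅕ * (-5ℚ * sumℚ (map f W))           ≡⟨ cong (-⅕ *_) (sym (sumℚ-* -5ℚ f W)) ⟩
    -⅕ * sumℚ (map (λ x → -5ℚ * f x) W)   ≡⟨ cong (-⅕ *_) (sym (sumℚ-cong W eigen)) ⟩
    -⅕ * sumℚ (map (Lap (suc (suc m)) f) W) ≡⟨ cong (-⅕ *_) (sum-Lap (suc (suc m)) f) ⟩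
    -⅕ * 0ℚ                               ≡⟨ ℚP.*-zeroʳ -⅕ ⟩
    0ℚ                                    ∎
    where
    open ≡-Reasoning
    fifths : ∀ s → s ≡ -⅕ * (-5ℚ * s)
    fifths = solve-∀ ℚ-ring
  triSum-w₀ : triSum f w₀ ≡ 0ℚ
  triSum-w₀ = sum-const-zero (suc m) (triSum f w₀)
    (trans (sumℚ-cong (allWords (suc m)) (triSum-constant (suc m) f (λ y _ → eigen y) w₀))
           (trans (sym (sum-triSum (suc m) f)) sum-f))

-- Eigenfunctions are combinations of cycle functions

ArcCycleRep : ∀ m → (Word (suc m) → ℚ) → (Letter → ℚ) → Coeffs (suc m) → Set
ArcCycleRep m g α c = ∀ y → g y ≡ Σ₃ (λ b → α b * arc b y) + cycleComb (suc m) c y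

-- The arcs sum to minus all cycles, so a constant can be moved from the arc to the cycle coefficients.
arcCycleRep-shift : ∀ m g α c t → ArcCycleRep m g α c → ArcCycleRep m g (λ b → α b - t) (λ k u → c k u - t)
arcCycleRep-shift m g α c t rep y = begin
  g y ≡⟨ rep y ⟩
  Σ₃ (λ b → α b * arc b y) + P
    ≡⟨ move-t (α 𝟎) (α 𝟏) (α 𝟐) (arc 𝟎 y) (arc 𝟏 y) (arc 𝟐 y) P S (Σ-arc≡-Σ-cycle m y) ⟩
  Σ₃ (λ b → (α b - t) * arc b y) + (P + (- t) * S)
    ≡⟨ cong (Σ₃ (λ b → (α b - t) * arc b y) +_) (sym shifted) ⟩
  Σ₃ (λ b → (α b - t) * arc b y) + cycleComb (suc m) (λ k u → c k u - t) y
    ∎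
  where
  open ≡-Reasoning
  P = cycleComb (suc m) c y
  S = cycleComb (suc m) (λ _ _ → 1ℚ) y
  shifted : cycleComb (suc m) (λ k u → c k u - t) y ≡ P + (- t) * S
  shifted = trans (sumBasis-cong (suc m) (λ k u _ _ → distrib (c k u) t (cycle (toList u) y)))
            (trans (sumBasis-+ (suc m) (λ k u → c k u * cycle (toList u) y) (λ k u → (- t) * (1ℚ * cycle (toList u) y)))
                   (cong (P +_) (sumBasis-* (suc m) (- t) (λ k u → 1ℚ * cycle (toList u) y))))
    where
    distrib : ∀ d t x → (d - t) * x ≡ d * x + (- t) * (1ℚ * x)
    distrib = solve-∀ ℚ-ring
  move-t : ∀ a₀ a₁ a₂ x₀ x₁ x₂ P S → x₀ + (x₁ + (x₂ + 0ℚ)) ≡ - S →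
    (a₀ * x₀ + (a₁ * x₁ + (a₂ * x₂ + 0ℚ))) + P ≡ ((a₀ - t) * x₀ + ((a₁ - t) * x₁ + ((a₂ - t) * x₂ + 0ℚ))) + (P + (- t) * S)
  move-t a₀ a₁ a₂ x₀ x₁ x₂ P S Σx≡-S =
    trans (expand a₀ a₁ a₂ x₀ x₁ x₂ t P S)
          (trans (cong (λ q → shifted-sum + t * q) (trans (cong (_+ S) Σx≡-S) (ℚP.+-inverseˡ S))) (drop shifted-sum t))
    where
    expand : ∀ a₀ a₁ a₂ x₀ x₁ x₂ t P S →
      (a₀ * x₀ + (a₁ * x₁ + (a₂ * x₂ + 0ℚ))) + P
        ≡ ((a₀ - t) * x₀ + ((a₁ - t) * x₁ + ((a₂ - t) * x₂ + 0ℚ))) + (P + (- t) * S) + t * ((x₀ + (x₁ + (x₂ + 0ℚ))) + S)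
    expand = solve-∀ ℚ-ring
    drop : ∀ X t → X + t * 0ℚ ≡ X
    drop = solve-∀ ℚ-ring
    shifted-sum = ((a₀ - t) * x₀ + ((a₁ - t) * x₁ + ((a₂ - t) * x₂ + 0ℚ))) + (P + (- t) * S)

Representation : ∀ m → (Word (suc m) → ℚ) → Letter → Set
Representation m g a₀ = Σ (Letter → ℚ) λ α → Σ (Coeffs (suc m)) λ c → (α a₀ ≡ 0ℚ) × ArcCycleRep m g α c

normalise : ∀ m g α c → ArcCycleRep m g α c → ∀ a₀ → Representation m g a₀
normalise m g α c rep a₀ =
  (λ b → α b - α a₀) , (λ k u → c k u - α a₀) , ℚP.+-inverseʳ (α a₀) , arcCycleRep-shift m g α c (α a₀) rep

Representable : ℕ → Set
Representable m = ∀ (g : Word (suc m) → ℚ) → EigenOffCorners (suc m) g → (∀ w → triSum g w ≡ 0ℚ) → ∀ a₀ → Representation m g a₀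

-- On a single triangle with g 𝟎 + g 𝟏 + g 𝟐 = 0, take α = (g 𝟏 , − g 𝟎 , 0).
representable-zero : Representable 0
representable-zero g _ triangle = normalise 0 g α (λ _ _ → 0ℚ) rep
  where
  g₀ = g (𝟎 ∷ [])
  g₁ = g (𝟏 ∷ [])
  g₂ = g (𝟐 ∷ [])
  α : Letter → ℚ
  α 𝟎 = g₁
  α 𝟏 = - g₀
  α 𝟐 = 0ℚ
  rep : ArcCycleRep 0 g α (λ _ _ → 0ℚ)
  rep (𝟎 ∷ []) = at₀ g₀ g₁
    where at₀ : ∀ g₀ g₁ → g₀ ≡ (g₁ * 0ℚ + ((- g₀) * (- 1ℚ) + (0ℚ * 1ℚ + 0ℚ))) + 0ℚ
          at₀ = solve-∀ ℚ-ring
  rep (𝟏 ∷ []) = at₁ g₀ g₁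
    where at₁ : ∀ g₀ g₁ → g₁ ≡ (g₁ * 1ℚ + ((- g₀) * 0ℚ + (0ℚ * (- 1ℚ) + 0ℚ))) + 0ℚ
          at₁ = solve-∀ ℚ-ring
  rep (𝟐 ∷ []) = trans (isolate g₀ g₁ g₂) (trans (cong (_- (g₀ + g₁)) (triangle [])) (at₂ g₀ g₁))
    where isolate : ∀ g₀ g₁ g₂ → g₂ ≡ (g₀ + (g₁ + (g₂ + 0ℚ))) - (g₀ + g₁)
          isolate = solve-∀ ℚ-ring
          at₂ : ∀ g₀ g₁ → 0ℚ - (g₀ + g₁) ≡ (g₁ * (- 1ℚ) + ((- g₀) * 1ℚ + (0ℚ * 0ℚ + 0ℚ))) + 0ℚ
          at₂ = solve-∀ ℚ-ring

assembleCoeffs : ∀ m → (Letter → Coeffs m) → ℚ → Coeffs (suc m)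
assembleCoeffs m       cs t zero    (a ∷ u) = cs a zero u
assembleCoeffs zero    cs t (suc k) u       = t
assembleCoeffs (suc m) cs t (suc k) u       = assembleCoeffs m (λ a k′ → cs a (suc k′)) t k u

assembleCoeffs-prepend : ∀ m cs t a k (u : Word (m ∸ k)) → k ℕ.≤ m → assembleCoeffs m cs t k (prepend a m k u) ≡ cs a k u
assembleCoeffs-prepend m       cs t a zero    u _          = refl
assembleCoeffs-prepend (suc m) cs t a (suc k) u (ℕ.s≤s k≤m) = assembleCoeffs-prepend m (λ a k′ → cs a (suc k′)) t a k u k≤m

assembleCoeffs-empty : ∀ m cs t → assembleCoeffs m cs t (suc m) (emptyIndex m) ≡ t
assembleCoeffs-empty zero    cs t = refl
assembleCoeffs-empty (suc m) cs t = assembleCoeffs-empty m (λ a k′ → cs a (suc k′)) t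

-- With α a a = 0, the junction relation between copies a and a′ says that the third
-- letter has the same arc coefficient in both copies.
junction-coeffs₀₁ : ∀ x₀ x₁ x₂ y₀ y₁ y₂ → x₀ ≡ 0ℚ → y₁ ≡ 0ℚ →
  (x₀ * 1ℚ + (x₁ * 0ℚ + (x₂ * (- 1ℚ) + 0ℚ))) + (y₀ * 0ℚ + (y₁ * (- 1ℚ) + (y₂ * 1ℚ + 0ℚ))) ≡ 0ℚ → x₂ ≡ y₂
junction-coeffs₀₁ x₀ x₁ x₂ y₀ y₁ y₂ refl refl e = trans (solve x₁ x₂ y₀ y₂) (trans (cong (λ q → y₂ - q) e) (ℚP.+-identityʳ y₂))
  where solve : ∀ x₁ x₂ y₀ y₂ →
                x₂ ≡ y₂ - ((0ℚ * 1ℚ + (x₁ * 0ℚ + (x₂ * (- 1ℚ) + 0ℚ))) + (y₀ * 0ℚ + (0ℚ * (- 1ℚ) + (y₂ * 1ℚ + 0ℚ))))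
        solve = solve-∀ ℚ-ring

junction-coeffs₀₂ : ∀ x₀ x₁ x₂ y₀ y₁ y₂ → x₀ ≡ 0ℚ → y₂ ≡ 0ℚ →
  (x₀ * (- 1ℚ) + (x₁ * 1ℚ + (x₂ * 0ℚ + 0ℚ))) + (y₀ * 0ℚ + (y₁ * (- 1ℚ) + (y₂ * 1ℚ + 0ℚ))) ≡ 0ℚ → x₁ ≡ y₁
junction-coeffs₀₂ x₀ x₁ x₂ y₀ y₁ y₂ refl refl e = trans (solve x₁ x₂ y₀ y₁) (trans (cong (y₁ +_) e) (ℚP.+-identityʳ y₁))
  where solve : ∀ x₁ x₂ y₀ y₁ →
                x₁ ≡ y₁ + ((0ℚ * (- 1ℚ) + (x₁ * 1ℚ + (x₂ * 0ℚ + 0ℚ))) + (y₀ * 0ℚ + (y₁ * (- 1ℚ) + (0ℚ * 1ℚ + 0ℚ))))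
        solve = solve-∀ ℚ-ring

junction-coeffs₁₂ : ∀ x₀ x₁ x₂ y₀ y₁ y₂ → x₁ ≡ 0ℚ → y₂ ≡ 0ℚ →
  (x₀ * (- 1ℚ) + (x₁ * 1ℚ + (x₂ * 0ℚ + 0ℚ))) + (y₀ * 1ℚ + (y₁ * 0ℚ + (y₂ * (- 1ℚ) + 0ℚ))) ≡ 0ℚ → x₀ ≡ y₀
junction-coeffs₁₂ x₀ x₁ x₂ y₀ y₁ y₂ refl refl e = trans (solve x₀ x₂ y₀ y₁) (trans (cong (λ q → y₀ - q) e) (ℚP.+-identityʳ y₀))
  where solve : ∀ x₀ x₂ y₀ y₁ →
                x₀ ≡ y₀ - ((x₀ * (- 1ℚ) + (0ℚ * 1ℚ + (x₂ * 0ℚ + 0ℚ))) + (y₀ * 1ℚ + (y₁ * 0ℚ + (0ℚ * (- 1ℚ) + 0ℚ))))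
        solve = solve-∀ ℚ-ring

module _ (m : ℕ) (g : Word (suc (suc m)) → ℚ) (eigen : EigenOffCorners (suc (suc m)) g) (triangle : ∀ w → triSum g w ≡ 0ℚ)
         (α : Letter → Letter → ℚ) (cs : Letter → Coeffs (suc m)) (α-diag : ∀ a → α a a ≡ 0ℚ)
         (reps : ∀ a → ArcCycleRep m (λ z → g (a ∷ z)) (α a) (cs a)) where

  private
    g-junction : ∀ a a′ → g (a ∷ replicate (suc m) a′) ≡ Σ₃ (λ b → α a b * orientation b a′)
    g-junction a a′ = trans (reps a (replicate (suc m) a′))
      (trans (cong₂ _+_ (Σ₃-cong (λ b → cong (α a b *_) (arc-replicate m b a′))) (cycleComb-replicate m (cs a) a′))
             (ℚP.+-identityʳ _))

    junction-relation : ∀ a a′ → a ≢ a′ → Σ₃ (λ b → α a b * orientation b a′) + Σ₃ (λ b → α a′ b * orientation b a) ≡ 0ℚ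
    junction-relation a a′ a≢a′ = trans (sym (cong₂ _+_ (g-junction a a′) (g-junction a′ a)))
      (trans (sym (trans (cong (λ q → q + g (a ∷ replicate (suc m) a′) + g (a′ ∷ replicate (suc m) a)) (triangle (a ∷ replicate m a′)))
                         (cong (_+ g (a′ ∷ replicate (suc m) a)) (ℚP.+-identityˡ (g (a ∷ replicate (suc m) a′))))))
             (junction-identity m g a a′ a≢a′ eigen))

    A : Letter → ℚ
    A 𝟎 = α 𝟏 𝟎
    A 𝟏 = α 𝟎 𝟏
    A 𝟐 = α 𝟎 𝟐

    α≡A : ∀ a b → a ≢ b → α a b ≡ A b
    α≡A 𝟎 𝟎 a≢b = ⊥-elim (a≢b refl)
    α≡A 𝟏 𝟏 a≢b = ⊥-elim (a≢b refl)
    α≡A 𝟐 𝟐 a≢b = ⊥-elim (a≢b refl)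
    α≡A 𝟏 𝟎 _ = refl
    α≡A 𝟎 𝟏 _ = refl
    α≡A 𝟎 𝟐 _ = refl
    α≡A 𝟐 𝟎 _ = sym (junction-coeffs₁₂ (α 𝟏 𝟎) (α 𝟏 𝟏) (α 𝟏 𝟐) (α 𝟐 𝟎) (α 𝟐 𝟏) (α 𝟐 𝟐)
                                        (α-diag 𝟏) (α-diag 𝟐) (junction-relation 𝟏 𝟐 (λ ())))
    α≡A 𝟐 𝟏 _ = sym (junction-coeffs₀₂ (α 𝟎 𝟎) (α 𝟎 𝟏) (α 𝟎 𝟐) (α 𝟐 𝟎) (α 𝟐 𝟏) (α 𝟐 𝟐)
                                        (α-diag 𝟎) (α-diag 𝟐) (junction-relation 𝟎 𝟐 (λ ())))
    α≡A 𝟏 𝟐 _ = sym (junction-coeffs₀₁ (α 𝟎 𝟎) (α 𝟎 𝟏) (α 𝟎 𝟐) (α 𝟏 𝟎) (α 𝟏 𝟏) (α 𝟏 𝟐)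
                                        (α-diag 𝟎) (α-diag 𝟏) (junction-relation 𝟎 𝟏 (λ ())))

    arc-term : ∀ a b X → α a b * X ≡ A b * (if a == b then 0ℚ else X)
    arc-term a b X = by-cases (a ≟L b)
      where
      by-cases : Dec (a ≡ b) → α a b * X ≡ A b * (if a == b then 0ℚ else X)
      by-cases (yes refl) = trans (cong (_* X) (α-diag a))
        (trans (ℚP.*-zeroˡ X) (sym (trans (cong (λ e → A a * (if e then 0ℚ else X)) (==-refl a)) (ℚP.*-zeroʳ (A a)))))
      by-cases (no a≢b) = trans (cong (_* X) (α≡A a b a≢b)) (cong (λ e → A b * (if e then 0ℚ else X)) (sym (≢⇒==-false a b a≢b)))

    c : Coeffs (suc (suc m))
    c = assembleCoeffs (suc m) cs 0ℚ

    cycleComb-c : ∀ a y → cycleComb (suc (suc m)) c (a ∷ y) ≡ cycleComb (suc m) (cs a) y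
    cycleComb-c a y = trans (cycleComb-∷ m c a y)
      (trans (cong₂ _+_ (sumBasis-cong (suc m) (λ k u _ k≤m → cong (_* cycle (toList u) y) (assembleCoeffs-prepend (suc m) cs 0ℚ a k u k≤m)))
                        (trans (cong (_* arc a y) (assembleCoeffs-empty (suc m) cs 0ℚ)) (ℚP.*-zeroˡ (arc a y))))
             (ℚP.+-identityʳ _))

  assembleRep : ArcCycleRep (suc m) g A c
  assembleRep (a ∷ y) = trans (reps a y)
    (cong₂ _+_ (Σ₃-cong (λ b → trans (arc-term a b (arc b y)) (cong (A b *_) (sym (arc-∷ b a y))))) (sym (cycleComb-c a y)))

  assembledArcCoeffs : Letter → ℚ
  assembledArcCoeffs = A

  assembledCoeffs : Coeffs (suc (suc m))
  assembledCoeffs = c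

representable-suc : ∀ m → Representable m → Representable (suc m)
representable-suc m IH g eigen triangle =
  normalise (suc m) g (assembledArcCoeffs m g eigen triangle α cs α-diag reps) (assembledCoeffs m g eigen triangle α cs α-diag reps)
                      (assembleRep m g eigen triangle α cs α-diag reps)
  where
  sub : ∀ a → Representation m (λ z → g (a ∷ z)) a
  sub a = IH (λ z → g (a ∷ z)) (EigenOffCorners-∷ (suc m) g a eigen) (λ w → triangle (a ∷ w)) a
  α : Letter → Letter → ℚ
  α a = proj₁ (sub a)
  cs : Letter → Coeffs (suc m)
  cs a = proj₁ (proj₂ (sub a))
  α-diag : ∀ a → α a a ≡ 0ℚ
  α-diag a = proj₁ (proj₂ (proj₂ (sub a)))
  reps : ∀ a → ArcCycleRep m (λ z → g (a ∷ z)) (α a) (cs a)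
  reps a = proj₂ (proj₂ (proj₂ (sub a)))

representable : ∀ m → Representable m
representable zero    = representable-zero
representable (suc m) = representable-suc m (representable m)

-- At a corner the loop contributes nothing, so there Lap f = triSum f − 3 f = −3 f.
eigen-corner-zero : ∀ m (f : Word (suc (suc m)) → ℚ) → (∀ x → Lap (suc (suc m)) f x ≡ -5ℚ * f x) →
                    ∀ c → f (replicate (suc (suc m)) c) ≡ 0ℚ
eigen-corner-zero m f eigen c =
  trans (solve-for fc) (trans (cong (λ q → ½ * (q - -5ℚ * fc)) -3f≡-5f) (cong (½ *_) (ℚP.+-inverseʳ (-5ℚ * fc))))
  where
  fc = f (replicate (suc (suc m)) c)
  -3f≡-5f : 0ℚ - 3ℚ * fc ≡ -5ℚ * fc
  -3f≡-5f = trans (cong (_- 3ℚ * fc) (sym (triSum-zero m f eigen (replicate (suc m) c))))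
                  (trans (sym (Lap-corner-triSum (suc m) f c)) (eigen (replicate (suc (suc m)) c)))
  solve-for : ∀ x → x ≡ ½ * ((0ℚ - 3ℚ * x) - -5ℚ * x)
  solve-for = solve-∀ ℚ-ring

-- f vanishes at the corners cᵐ, where every cycle vanishes and arc b takes the value orientation b c.
arcCoeffs-zero : ∀ m (f : Word (suc (suc m)) → ℚ) → (∀ x → Lap (suc (suc m)) f x ≡ -5ℚ * f x) →
                 ∀ α c → α 𝟎 ≡ 0ℚ → ArcCycleRep (suc m) f α c → ∀ b → α b ≡ 0ℚ
arcCoeffs-zero m f eigen α c α₀ rep = λ { 𝟎 → α₀ ; 𝟏 → α₁ ; 𝟐 → α₂ }
  where
  at-corner : ∀ e → Σ₃ (λ b → α b * orientation b e) ≡ 0ℚ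
  at-corner e = trans (sym (ℚP.+-identityʳ _))
    (trans (cong₂ _+_ (Σ₃-cong (λ b → cong (α b *_) (sym (arc-replicate (suc m) b e)))) (sym (cycleComb-replicate (suc m) c e)))
           (trans (sym (rep (replicate (suc (suc m)) e))) (eigen-corner-zero m f eigen e)))
  α₂ : α 𝟐 ≡ 0ℚ
  α₂ = solve-for (α 𝟎) (α 𝟏) (α 𝟐) α₀ (at-corner 𝟏)
    where solve-for : ∀ a₀ a₁ a₂ → a₀ ≡ 0ℚ → a₀ * 1ℚ + (a₁ * 0ℚ + (a₂ * (- 1ℚ) + 0ℚ)) ≡ 0ℚ → a₂ ≡ 0ℚ
          solve-for a₀ a₁ a₂ refl e = trans (rearrange a₁ a₂) (cong -_ e)
            where rearrange : ∀ a₁ a₂ → a₂ ≡ - (0ℚ * 1ℚ + (a₁ * 0ℚ + (a₂ * (- 1ℚ) + 0ℚ)))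
                  rearrange = solve-∀ ℚ-ring
  α₁ : α 𝟏 ≡ 0ℚ
  α₁ = solve-for (α 𝟎) (α 𝟏) (α 𝟐) α₀ (at-corner 𝟐)
    where solve-for : ∀ a₀ a₁ a₂ → a₀ ≡ 0ℚ → a₀ * (- 1ℚ) + (a₁ * 1ℚ + (a₂ * 0ℚ + 0ℚ)) ≡ 0ℚ → a₁ ≡ 0ℚ
          solve-for a₀ a₁ a₂ refl e = trans (rearrange a₁ a₂) e
            where rearrange : ∀ a₁ a₂ → a₁ ≡ 0ℚ * (- 1ℚ) + (a₁ * 1ℚ + (a₂ * 0ℚ + 0ℚ))
                  rearrange = solve-∀ ℚ-ring

cycleComb-span : ∀ m (f : Word (suc (suc m)) → ℚ) → (∀ x → Lap (suc (suc m)) f x ≡ -5ℚ * f x) →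
                 Σ (Coeffs (suc (suc m))) λ c → ∀ x → f x ≡ cycleComb (suc (suc m)) c x
cycleComb-span m f eigen = c , λ x → trans (rep x) (trans (cong (_+ cycleComb (suc (suc m)) c x) (no-arcs x)) (ℚP.+-identityˡ _))
  where
  R = representable (suc m) f (λ y _ → eigen y) (triSum-zero m f eigen) 𝟎
  α = proj₁ R
  c = proj₁ (proj₂ R)
  rep = proj₂ (proj₂ (proj₂ R))
  α≡0 = arcCoeffs-zero m f eigen α c (proj₁ (proj₂ (proj₂ R))) rep
  no-arcs : ∀ x → Σ₃ (λ b → α b * arc b x) ≡ 0ℚ
  no-arcs x = Σ₃-cong {h = λ _ → 0ℚ} (λ b → trans (cong (_* arc b x) (α≡0 b)) (ℚP.*-zeroˡ (arc b x)))

-- Alternating functions are the cycle functions up to sign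

Opposite : ℚ → ℚ → Set
Opposite p q = (p ≡ 0ℚ) ⊎ (q ≡ 0ℚ) ⊎ (p ≡ - q)

Opposite? : ∀ p q → Dec (Opposite p q)
Opposite? p q = (p ℚP.≟ 0ℚ) ⊎-dec ((q ℚP.≟ 0ℚ) ⊎-dec (p ℚP.≟ - q))

Opposite-subst : ∀ {p p′ q q′} → p ≡ p′ → q ≡ q′ → Opposite p′ q′ → Opposite p q
Opposite-subst refl refl o = o

Opposite-if-0 : ∀ b {p q} → Opposite p q → Opposite (if b then 0ℚ else p) (if b then 0ℚ else q)
Opposite-if-0 true  _ = inj₁ refl
Opposite-if-0 false o = o

Opposite-0-if : ∀ b {p q} → Opposite p q → Opposite (if b then p else 0ℚ) (if b then q else 0ℚ)
Opposite-0-if true  o = o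
Opposite-0-if false _ = inj₁ refl

orientation-opposite : ∀ a b → Opposite (orientation a b) (orientation b a)
orientation-opposite = decide₂ (λ a b → Opposite? (orientation a b) (orientation b a))

arc-junction₁-opposite : ∀ a c d → c ≢ d → Opposite (arc a (c ∷ [])) (arc a (d ∷ []))
arc-junction₁-opposite = decide₃ (λ a c d → ¬? (c ≟L d) →-dec Opposite? (arc a (c ∷ [])) (arc a (d ∷ [])))

arc-junction-opposite : ∀ a c d → c ≢ d →
  Opposite (if c == a then 0ℚ else orientation a d) (if d == a then 0ℚ else orientation a c)
arc-junction-opposite = decide₃ (λ a c d → ¬? (c ≟L d) →-dec
  Opposite? (if c == a then 0ℚ else orientation a d) (if d == a then 0ℚ else orientation a c))

arc-opposite : ∀ m a (x y : Word m) → x ≢ y → ShareJNeighbour x y → Opposite (arc a x) (arc a y)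
arc-opposite zero a [] [] x≢y _ = ⊥-elim (x≢y refl)
arc-opposite (suc zero) a (c ∷ []) (d ∷ []) x≢y _ = arc-junction₁-opposite a c d (λ { refl → x≢y refl })
arc-opposite (suc (suc m)) a (c ∷ x) (d ∷ y) x≢y share = by-cases (c ≟L d)
  where
  junction : (x ≡ replicate (suc m) d) × (y ≡ replicate (suc m) c) → c ≢ d → Opposite (arc a (c ∷ x)) (arc a (d ∷ y))
  junction (refl , refl) c≢d =
    Opposite-subst (arc-∷-replicate m a c d) (arc-∷-replicate m a d c) (arc-junction-opposite a c d c≢d)
  by-cases : Dec (c ≡ d) → Opposite (arc a (c ∷ x)) (arc a (d ∷ y))
  by-cases (yes refl) = Opposite-subst (arc-∷ a c x) (arc-∷ a c y)
    (Opposite-if-0 (c == a) (arc-opposite (suc m) a x y (λ x≡y → x≢y (cong (c ∷_) x≡y)) (share-∷⁻ c share)))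
  by-cases (no c≢d) = junction (share-junction⁻ c d x y c≢d share) c≢d

cycle-opposite : ∀ m U (x y : Word m) → x ≢ y → ShareJNeighbour x y → Opposite (cycle U x) (cycle U y)
cycle-opposite zero U [] [] x≢y _ = ⊥-elim (x≢y refl)
cycle-opposite (suc m) [] (a ∷ x) (b ∷ y) x≢y share = by-cases (a ≟L b)
  where
  junction : ∀ m → Opposite (arc a (replicate m b)) (arc b (replicate m a))
  junction zero    = inj₁ refl
  junction (suc m) = Opposite-subst (arc-replicate m a b) (arc-replicate m b a) (orientation-opposite a b)
  by-cases : Dec (a ≡ b) → Opposite (arc a x) (arc b y)
  by-cases (yes refl) = arc-opposite m a x y (λ x≡y → x≢y (cong (a ∷_) x≡y)) (share-∷⁻ a share)
  by-cases (no a≢b) with share-junction⁻ a b x y a≢b share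
  ... | refl , refl = junction m
cycle-opposite (suc m) (c ∷ U) (a ∷ x) (b ∷ y) x≢y share = by-cases (a ≟L b)
  where
  by-cases : Dec (a ≡ b) → Opposite (cycle (c ∷ U) (a ∷ x)) (cycle (c ∷ U) (b ∷ y))
  by-cases (yes refl) = Opposite-0-if (c == a) (cycle-opposite m U x y (λ x≡y → x≢y (cong (a ∷_) x≡y)) (share-∷⁻ a share))
  by-cases (no a≢b) = other-copy (c ≟L a)
    where
    other-copy : Dec (c ≡ a) → Opposite (cycle (c ∷ U) (a ∷ x)) (cycle (c ∷ U) (b ∷ y))
    other-copy (yes refl) = inj₂ (inj₁ (if-false (≢⇒==-false c b a≢b)))
    other-copy (no c≢a)   = inj₁ (if-false (≢⇒==-false c a c≢a))

-- Pads with 𝟎 or truncates; only applied to lists of length n.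
fromList : ∀ n → List Letter → Word n
fromList zero _ = []
fromList (suc n) [] = 𝟎 ∷ fromList n []
fromList (suc n) (a ∷ l) = a ∷ fromList n l

toList-fromList : ∀ n l → L.length l ≡ n → toList (fromList n l) ≡ l
toList-fromList zero [] _ = refl
toList-fromList (suc n) (a ∷ l) e = cong (a ∷_) (toList-fromList n l (ℕP.suc-injective e))

fromList-toList : ∀ {n} (x : Word n) → fromList n (toList x) ≡ x
fromList-toList [] = refl
fromList-toList (a ∷ x) = cong (a ∷_) (fromList-toList x)

==-false⇒≢ : ∀ a b → (a == b) ≡ false → a ≢ b
==-false⇒≢ a b e refl with trans (sym e) (==-refl a)
... | ()

cycleList-prefix : ∀ U j r → cycleList U (U ++ j ∷ r) ≡ arcList j r
cycleList-prefix [] j r = refl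
cycleList-prefix (a ∷ U) j r = trans (if-true (==-refl a)) (cycleList-prefix U j r)

PlusMinus : ℚ → Set
PlusMinus v = (v ≡ 1ℚ) ⊎ (v ≡ - 1ℚ)

PlusMinus? : ∀ v → Dec (PlusMinus v)
PlusMinus? v = (v ℚP.≟ 1ℚ) ⊎-dec (v ℚP.≟ - 1ℚ)

orientation-±1 : ∀ j c → c ≢ j → PlusMinus (orientation j c)
orientation-±1 = decide₂ (λ j c → ¬? (c ≟L j) →-dec PlusMinus? (orientation j c))

arcFrom-±1 : ∀ j c r → c ≢ j → All (_≢ j) r → PlusMinus (arcFrom j c r)
arcFrom-±1 j c [] ne _ = orientation-±1 j c ne
arcFrom-±1 j c (d ∷ r) ne (d≢j ∷ avoids) = subst PlusMinus (sym (if-false (≢⇒==-false d j d≢j))) (arcFrom-±1 j d r d≢j avoids)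

arcList-±1 : ∀ j c r → All (_≢ j) (c ∷ r) → PlusMinus (arcList j (c ∷ r))
arcList-±1 j c r (c≢j ∷ avoids) = subst PlusMinus (sym (if-false (≢⇒==-false c j c≢j))) (arcFrom-±1 j c r c≢j avoids)

arcFrom-nonzero : ∀ j c r → arcFrom j c r ≢ 0ℚ → All (_≢ j) r
arcFrom-nonzero j c [] h = []
arcFrom-nonzero j c (d ∷ r) h = go ((d == j)) refl
  where
  go : ∀ b → (d == j) ≡ b → All (_≢ j) (d ∷ r)
  go true e = ⊥-elim (h (if-true e))
  go false e = ==-false⇒≢ d j e ∷ arcFrom-nonzero j d r (λ z → h (trans (if-false e) z))

arcList-nonzero : ∀ j r → arcList j r ≢ 0ℚ → All (_≢ j) r
arcList-nonzero j [] h = []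
arcList-nonzero j (c ∷ r) h = go ((c == j)) refl
  where
  go : ∀ b → (c == j) ≡ b → All (_≢ j) (c ∷ r)
  go true e = ⊥-elim (h (if-true e))
  go false e = ==-false⇒≢ c j e ∷ arcFrom-nonzero j c r (λ z → h (trans (if-false e) z))

cycleList-nonzero : ∀ U X → cycleList U X ≢ 0ℚ → Σ Letter λ j → Σ (List Letter) λ r → (X ≡ U ++ j ∷ r) × All (_≢ j) r
cycleList-nonzero [] [] h = ⊥-elim (h refl)
cycleList-nonzero [] (j ∷ r) h = j , r , refl , arcList-nonzero j r h
cycleList-nonzero (a ∷ U) [] h = ⊥-elim (h refl)
cycleList-nonzero (a ∷ U) (b ∷ X) h = go ((a == b)) refl
  where
  go : ∀ bb → (a == b) ≡ bb → Σ Letter λ j → Σ (List Letter) λ r → (b ∷ X ≡ (a ∷ U) ++ j ∷ r) × All (_≢ j) r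
  go true e with cycleList-nonzero U X (λ z → h (trans (if-true e) z))
  ... | j , r , e′ , avoids = j , r , cong₂ _∷_ (sym (==⇒≡ a b e)) e′ , avoids
  go false e = ⊥-elim (h (if-false e))

length-tail : ∀ n k L′ → k ℕ.≤ n → n ≡ (n ∸ k) ℕ.+ suc L′ → k ∸ 1 ≡ L′
length-tail n k L′ k≤n e =
  cong (_∸ 1) (trans (sym (ℕP.m∸[m∸n]≡n k≤n)) (trans (cong (_∸ (n ∸ k)) e) (ℕP.m+n∸m≡n (n ∸ k) (suc L′))))

inCycle : ∀ n k (u : Word (n ∸ k)) (x : Word n) j r → k ℕ.≤ n → toList x ≡ toList u ++ j ∷ r → All (_≢ j) r → InCycle n k u x
inCycle n k u x j r k≤n e avoids =
  j , fromList (k ∸ 1) r , subst (All (_≢ j)) (sym toList-r′) avoids , trans e (cong (λ l → toList u ++ j ∷ l) (sym toList-r′))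
  where
  length-x : n ≡ (n ∸ k) ℕ.+ suc (L.length r)
  length-x = trans (sym (VecP.length-toList x))
             (trans (cong L.length e) (trans (LP.length-++ (toList u)) (cong (ℕ._+ suc (L.length r)) (VecP.length-toList u))))
  toList-r′ : toList (fromList (k ∸ 1) r) ≡ r
  toList-r′ = toList-fromList (k ∸ 1) r (sym (length-tail n k (L.length r) k≤n length-x))

cycle-±1 : ∀ n k (u : Word (n ∸ k)) x → 2 ℕ.≤ k → InCycle n k u x → PlusMinus (cycle (toList u) x)
cycle-±1 n (suc zero) u x (ℕ.s≤s ()) _
cycle-±1 n (suc (suc k)) u x _ (j , (c ∷ u′) , avoids , x≡ujr) =
  subst PlusMinus (sym (trans (cong (cycleList (toList u)) x≡ujr) (cycleList-prefix (toList u) j (c ∷ toList u′))))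
                  (arcList-±1 j c (toList u′) avoids)

±1-nonzero : ∀ {v} → PlusMinus v → v ≢ 0ℚ
±1-nonzero (inj₁ refl) ()
±1-nonzero (inj₂ refl) ()

±1-square : ∀ {v} → PlusMinus v → v * v ≡ 1ℚ
±1-square (inj₁ refl) = refl
±1-square (inj₂ refl) = refl

cycle-nonzero⇒InCycle : ∀ n k (u : Word (n ∸ k)) x → k ℕ.≤ n → cycle (toList u) x ≢ 0ℚ → InCycle n k u x
cycle-nonzero⇒InCycle n k u x k≤n h with cycleList-nonzero (toList u) (toList x) h
... | j , r , e , avoids = inCycle n k u x j r k≤n e avoids

cycle-offCycle : ∀ n k (u : Word (n ∸ k)) x → k ℕ.≤ n → ¬ InCycle n k u x → cycle (toList u) x ≡ 0ℚ
cycle-offCycle n k u x k≤n off with cycle (toList u) x ℚP.≟ 0ℚ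
... | yes e = e
... | no ne = ⊥-elim (off (cycle-nonzero⇒InCycle n k u x k≤n ne))

cycle-isAlternating : ∀ n k (u : Word (n ∸ k)) → 2 ℕ.≤ k → k ℕ.≤ n → IsAlternating n k u (λ x → cycle (toList u) x)
cycle-isAlternating n k u 2≤k k≤n = (λ x off → cycle-offCycle n k u x k≤n off) , (λ x on → cycle-±1 n k u x 2≤k on) , alt
  where
  alt : ∀ x y → InCycle n k u x → InCycle n k u y → x ≢ y → ShareJNeighbour x y → cycle (toList u) x ≡ - cycle (toList u) y
  alt x y ix iy x≢y share with cycle-opposite n (toList u) x y x≢y share
  ... | inj₁ z = ⊥-elim (±1-nonzero (cycle-±1 n k u x 2≤k ix) z)
  ... | inj₂ (inj₁ z) = ⊥-elim (±1-nonzero (cycle-±1 n k u y 2≤k iy) z)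
  ... | inj₂ (inj₂ z) = z


FwList : List Letter → Point → Point
FwList [] z = z
FwList (j ∷ w) z = F j (FwList w z)

Fw≡FwList : ∀ {m} (x : Word m) z → Fw x z ≡ FwList (toList x) z
Fw≡FwList [] z = refl
Fw≡FwList (j ∷ x) z = cong (F j) (Fw≡FwList x z)

FwList-++ : ∀ P w z → FwList (P ++ w) z ≡ FwList P (FwList w z)
FwList-++ [] w z = refl
FwList-++ (j ∷ P) w z = cong (F j) (FwList-++ P w z)

FwList-replicate : ∀ t b → FwList (L.replicate t b) (p b) ≡ p b
FwList-replicate zero b = refl
FwList-replicate (suc t) b = trans (cong (F b) (FwList-replicate t b)) (F-fixes-p b)

FwList-junction : ∀ P a b t → FwList (P ++ a ∷ L.replicate t b) (p b) ≡ FwList (P ++ b ∷ L.replicate t a) (p a)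
FwList-junction P a b t = begin
  FwList (P ++ a ∷ L.replicate t b) (p b)           ≡⟨ FwList-++ P (a ∷ L.replicate t b) (p b) ⟩
  FwList P (F a (FwList (L.replicate t b) (p b)))   ≡⟨ cong (λ z → FwList P (F a z)) (FwList-replicate t b) ⟩
  FwList P (F a (p b))                              ≡⟨ cong (FwList P) (F-p-comm a b) ⟩
  FwList P (F b (p a))                              ≡⟨ cong (λ z → FwList P (F b z)) (sym (FwList-replicate t a)) ⟩
  FwList P (F b (FwList (L.replicate t a) (p a)))   ≡⟨ sym (FwList-++ P (b ∷ L.replicate t a) (p a)) ⟩
  FwList (P ++ b ∷ L.replicate t a) (p a)           ∎
  where open ≡-Reasoning

next : Letter → Letter
next 𝟎 = 𝟏
next 𝟏 = 𝟐
next 𝟐 = 𝟎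

prev : Letter → Letter
prev 𝟎 = 𝟐
prev 𝟏 = 𝟎
prev 𝟐 = 𝟏

next≢ : ∀ j → next j ≢ j
next≢ 𝟎 ()
next≢ 𝟏 ()
next≢ 𝟐 ()

prev≢ : ∀ j → prev j ≢ j
prev≢ 𝟎 ()
prev≢ 𝟏 ()
prev≢ 𝟐 ()

prev≢next : ∀ j → prev j ≢ next j
prev≢next 𝟎 ()
prev≢next 𝟏 ()
prev≢next 𝟐 ()

next-or-prev : ∀ j c → c ≢ j → (c ≡ next j) ⊎ (c ≡ prev j)
next-or-prev = decide₂ (λ j c → ¬? (c ≟L j) →-dec ((c ≟L next j) ⊎-dec (c ≟L prev j)))

neg*neg : ∀ a b → (- a) * (- b) ≡ a * b
neg*neg = solve-∀ ℚ-ring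

-- φ ψ keeps its value along every edge of the cycle (both factors change sign), and each vertex
-- u j r of the cycle is joined to u j (next j)ᵏ⁻¹ by edges P b aᵗ — P a bᵗ that straighten r letter
-- by letter, these base points being joined to each other; so φ ψ is a constant ε, and ε² = 1.
module Uniqueness (n k : ℕ) (u : Word (n ∸ k)) (φ : Word n → ℚ) (2≤k : 2 ℕ.≤ k) (k≤n : k ℕ.≤ n)
            (alt : IsAlternating n k u φ) where

  U : List Letter
  U = toList u

  ψ : Word n → ℚ
  ψ x = cycle U x

  φψ : Word n → ℚ
  φψ x = φ x * ψ x

  φψ-list : List Letter → ℚ
  φψ-list l = φψ (fromList n l)

  ℓ : ℕ
  ℓ = k ∸ 1

  InCycleList : List Letter → Set
  InCycleList l = Σ Letter λ j → Σ (List Letter) λ r → (l ≡ U ++ j ∷ r) × All (_≢ j) r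

  suc-ℓ : suc ℓ ≡ k
  suc-ℓ = go k 2≤k
    where go : ∀ k → 2 ℕ.≤ k → suc (k ∸ 1) ≡ k
          go (suc k) _ = refl

  length-cycleWord : ∀ j r → L.length r ≡ ℓ → L.length (U ++ j ∷ r) ≡ n
  length-cycleWord j r e = trans (LP.length-++ U) (trans (cong₂ (λ a b → a ℕ.+ suc b) (VecP.length-toList u) e)
                 (trans (cong ((n ∸ k) ℕ.+_) suc-ℓ) (ℕP.m∸n+n≡m k≤n)))

  fromList-InCycle : ∀ l → L.length l ≡ n → InCycleList l → InCycle n k u (fromList n l)
  fromList-InCycle l len (j , r , e , al) = inCycle n k u (fromList n l) j r k≤n (trans (toList-fromList n l len) e) al

  φψ-junction : ∀ prefix a b t → a ≢ b → L.length (prefix ++ a ∷ L.replicate t b) ≡ n →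
          InCycleList (prefix ++ a ∷ L.replicate t b) → InCycleList (prefix ++ b ∷ L.replicate t a) →
          φψ-list (prefix ++ a ∷ L.replicate t b) ≡ φψ-list (prefix ++ b ∷ L.replicate t a)
  φψ-junction prefix a b t a≢b len on₁ on₂ = trans (cong (_* ψ x) (φalt)) (trans (cong (- φ y *_) ψalt) (neg*neg (φ y) (ψ y)))
    where
    l1 = prefix ++ a ∷ L.replicate t b
    l2 = prefix ++ b ∷ L.replicate t a
    len2 : L.length l2 ≡ n
    len2 = trans (LP.length-++ prefix)
                 (trans (cong (λ z → L.length prefix ℕ.+ suc z) (trans (LP.length-replicate t) (sym (LP.length-replicate t))))
                        (trans (sym (LP.length-++ prefix)) len))
    x = fromList n l1
    y = fromList n l2
    toList-x : toList x ≡ l1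
    toList-x = toList-fromList n l1 len
    toList-y : toList y ≡ l2
    toList-y = toList-fromList n l2 len2
    x≢y : x ≢ y
    x≢y e = a≢b (LP.∷-injectiveˡ (LP.++-cancelˡ prefix _ _ (trans (sym toList-x) (trans (cong toList e) toList-y))))
    share : ShareJNeighbour x y
    share = b , a , trans (Fw≡FwList x (p b)) (trans (cong (λ l → FwList l (p b)) toList-x)
                 (trans (FwList-junction prefix a b t) (trans (cong (λ l → FwList l (p a)) (sym toList-y)) (sym (Fw≡FwList y (p a))))))
    ix = fromList-InCycle l1 len on₁
    iy = fromList-InCycle l2 len2 on₂
    φalt : φ x ≡ - φ y
    φalt = proj₂ (proj₂ alt) x y ix iy x≢y share
    ψalt : ψ x ≡ - ψ y
    ψalt = proj₂ (proj₂ (cycle-isAlternating n k u 2≤k k≤n)) x y ix iy x≢y share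

  length-++-cong : ∀ P (w w' : List Letter) → L.length w ≡ L.length w' → L.length (P ++ w) ≡ L.length (P ++ w')
  length-++-cong P w w' e = trans (LP.length-++ P) (trans (cong (L.length P ℕ.+_) e) (sym (LP.length-++ P)))

  snoc-assoc : ∀ P c (w : List Letter) → P ++ c ∷ w ≡ (P ++ c ∷ []) ++ w
  snoc-assoc P c w = sym (LP.++-assoc P (c ∷ []) w)

  φψ-on : Letter → List Letter → ℚ
  φψ-on j r = φψ-list (U ++ j ∷ r)

  Straighten : ℕ → Set
  Straighten t = ∀ j P w → L.length w ≡ t → L.length (P ++ w) ≡ ℓ → All (_≢ j) P → All (_≢ j) w →
            φψ-on j (P ++ w) ≡ φψ-on j (P ++ L.replicate t (next j))

  straighten-suc : ∀ t → Straighten t → Straighten (suc t)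
  straighten-suc t IH j P (c ∷ w) len-w len-Pw P-avoids (c≢j ∷ w-avoids) = go (next-or-prev j c c≢j)
    where
    len-w′ : L.length w ≡ t
    len-w′ = ℕP.suc-injective len-w
    a = next j
    b = prev j
    IH-c : φψ-on j ((P ++ c ∷ []) ++ w) ≡ φψ-on j ((P ++ c ∷ []) ++ L.replicate t a)
    IH-c = IH j (P ++ c ∷ []) w len-w′ (trans (cong L.length (sym (snoc-assoc P c w))) len-Pw) (AllP.++⁺ P-avoids (c≢j ∷ [])) w-avoids
    go : (c ≡ next j) ⊎ (c ≡ prev j) → φψ-on j (P ++ c ∷ w) ≡ φψ-on j (P ++ L.replicate (suc t) a)
    go (inj₁ refl) = trans (cong (φψ-on j) (snoc-assoc P c w)) (trans IH-c (cong (φψ-on j) (sym (snoc-assoc P c (L.replicate t a)))))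
    go (inj₂ refl) = begin
      φψ-on j (P ++ c ∷ w)                            ≡⟨ cong (φψ-on j) (snoc-assoc P c w) ⟩
      φψ-on j ((P ++ c ∷ []) ++ w)                    ≡⟨ IH-c ⟩
      φψ-on j ((P ++ c ∷ []) ++ L.replicate t a)      ≡⟨ cong (φψ-on j) (sym (snoc-assoc P c (L.replicate t a))) ⟩
      φψ-on j (P ++ b ∷ L.replicate t a)              ≡⟨ edge ⟩
      φψ-on j (P ++ a ∷ L.replicate t b)              ≡⟨ cong (φψ-on j) (snoc-assoc P a (L.replicate t b)) ⟩
      φψ-on j ((P ++ a ∷ []) ++ L.replicate t b)      ≡⟨ IH-a ⟩
      φψ-on j ((P ++ a ∷ []) ++ L.replicate t a)      ≡⟨ cong (φψ-on j) (sym (snoc-assoc P a (L.replicate t a))) ⟩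
      φψ-on j (P ++ L.replicate (suc t) a)            ∎
      where
      open ≡-Reasoning
      len-b : L.length (P ++ b ∷ L.replicate t a) ≡ ℓ
      len-b = trans (length-++-cong P (b ∷ L.replicate t a) (c ∷ w) (cong suc (trans (LP.length-replicate t) (sym len-w′)))) len-Pw
      len-a : L.length (P ++ a ∷ L.replicate t b) ≡ ℓ
      len-a = trans (length-++-cong P (a ∷ L.replicate t b) (c ∷ w) (cong suc (trans (LP.length-replicate t) (sym len-w′)))) len-Pw
      prefix = U ++ j ∷ P
      prefix-assoc : ∀ X → prefix ++ X ≡ U ++ j ∷ (P ++ X)
      prefix-assoc X = LP.++-assoc U (j ∷ P) X
      edge : φψ-on j (P ++ b ∷ L.replicate t a) ≡ φψ-on j (P ++ a ∷ L.replicate t b)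
      edge = trans (cong φψ-list (sym (prefix-assoc (b ∷ L.replicate t a))))
               (trans (φψ-junction prefix b a t (prev≢next j) (trans (cong L.length (prefix-assoc (b ∷ L.replicate t a))) (length-cycleWord j _ len-b))
                         (j , P ++ b ∷ L.replicate t a , prefix-assoc _ , AllP.++⁺ P-avoids (prev≢ j ∷ AllP.replicate⁺ t (next≢ j)))
                         (j , P ++ a ∷ L.replicate t b , prefix-assoc _ , AllP.++⁺ P-avoids (next≢ j ∷ AllP.replicate⁺ t (prev≢ j))))
                 (cong φψ-list (prefix-assoc (a ∷ L.replicate t b))))
      IH-a : φψ-on j ((P ++ a ∷ []) ++ L.replicate t b) ≡ φψ-on j ((P ++ a ∷ []) ++ L.replicate t a)
      IH-a = IH j (P ++ a ∷ []) (L.replicate t b) (LP.length-replicate t) (trans (cong L.length (sym (snoc-assoc P a (L.replicate t b)))) len-a)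
              (AllP.++⁺ P-avoids (next≢ j ∷ [])) (AllP.replicate⁺ t (prev≢ j))

  straighten : ∀ t → Straighten t
  straighten zero j P [] _ _ _ _ = refl
  straighten (suc t) = straighten-suc t (straighten t)

  φψ-base : Letter → ℚ
  φψ-base j = φψ-on j (L.replicate ℓ (next j))

  φψ-on≡base : ∀ j r → L.length r ≡ ℓ → All (_≢ j) r → φψ-on j r ≡ φψ-base j
  φψ-on≡base j r len al = straighten ℓ j [] r len len [] al

  φψ-base≡ : ∀ j → φψ-base j ≡ φψ-base 𝟎
  φψ-base≡ j with j ≟L 𝟎
  ... | yes refl = refl
  ... | no ne = trans (sym (φψ-on≡base j (L.replicate ℓ 𝟎) (LP.length-replicate ℓ) (AllP.replicate⁺ ℓ (λ e → ne (sym e)))))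
                  (trans (φψ-junction U j 𝟎 ℓ ne (length-cycleWord j _ (LP.length-replicate ℓ))
                            (j , L.replicate ℓ 𝟎 , refl , AllP.replicate⁺ ℓ (λ e → ne (sym e)))
                            (𝟎 , L.replicate ℓ j , refl , AllP.replicate⁺ ℓ ne))
                    (φψ-on≡base 𝟎 (L.replicate ℓ j) (LP.length-replicate ℓ) (AllP.replicate⁺ ℓ ne)))

  φψ-onCycle : ∀ x → InCycle n k u x → φψ x ≡ φψ-base 𝟎
  φψ-onCycle x (j , u′ , avoids , x≡ujr) =
    trans (cong φψ (sym (fromList-toList x)))
    (trans (cong φψ-list x≡ujr) (trans (φψ-on≡base j (toList u′) (VecP.length-toList u′) avoids) (φψ-base≡ j)))

  ε : ℚ
  ε = φψ-base 𝟎

  x₀ : Word n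
  x₀ = fromList n (U ++ 𝟎 ∷ L.replicate ℓ 𝟏)

  x₀-onCycle : InCycle n k u x₀
  x₀-onCycle = fromList-InCycle (U ++ 𝟎 ∷ L.replicate ℓ 𝟏) (length-cycleWord 𝟎 _ (LP.length-replicate ℓ))
                                (𝟎 , L.replicate ℓ 𝟏 , refl , AllP.replicate⁺ ℓ (λ ()))

  ε²≡1 : ε * ε ≡ 1ℚ
  ε²≡1 = trans (regroup (φ x₀) (ψ x₀))
               (cong₂ _*_ (±1-square (proj₁ (proj₂ alt) x₀ x₀-onCycle)) (±1-square (cycle-±1 n k u x₀ 2≤k x₀-onCycle)))
    where regroup : ∀ a b → (a * b) * (a * b) ≡ (a * a) * (b * b)
          regroup = solve-∀ ℚ-ring

  φ≡εψ : ∀ x → φ x ≡ ε * ψ x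
  φ≡εψ x with ψ x ℚP.≟ 0ℚ
  ... | yes z = trans (proj₁ alt x (λ ic → ±1-nonzero (cycle-±1 n k u x 2≤k ic) z)) (sym (trans (cong (ε *_) z) (ℚP.*-zeroʳ ε)))
  ... | no nz = trans (sym (trans (cong (φ x *_) (±1-square (cycle-±1 n k u x 2≤k ic))) (ℚP.*-identityʳ (φ x))))
                  (trans (sym (ℚP.*-assoc (φ x) (ψ x) (ψ x))) (cong (_* ψ x) (φψ-onCycle x ic)))
    where ic = cycle-nonzero⇒InCycle n k u x k≤n nz

alternating≡±cycle : ∀ n k (u : Word (n ∸ k)) (φ : Word n → ℚ) → 2 ℕ.≤ k → k ℕ.≤ n → IsAlternating n k u φ →
  Σ ℚ λ ε → (ε * ε ≡ 1ℚ) × (∀ x → φ x ≡ ε * cycle (toList u) x)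
alternating≡±cycle n k u φ 2≤k k≤n alt = ε , ε²≡1 , φ≡εψ
  where open Uniqueness n k u φ 2≤k k≤n alt

Rescaling : ∀ n → Family n → Family n → Set
Rescaling n φ ψ = Σ (Coeffs n) λ ε → ∀ k → 2 ℕ.≤ k → k ℕ.≤ n → ∀ u →
                    (ε k u * ε k u ≡ 1ℚ) × (∀ x → φ k u x ≡ ε k u * ψ k u x)

ΔH-cong : ∀ n {f g : Word n → ℚ} x → (∀ z → f z ≡ g z) → ΔH n f x ≡ ΔH n g x
ΔH-cong n x f≗g = cong (ℤ.+ 1 Q./ 3 *_) (Lap-cong n x f≗g)

IsEigenfunction-scale : ∀ n λ′ k {g : Word n → ℚ} → IsEigenfunction n λ′ g → IsEigenfunction n λ′ (λ z → k * g z)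
IsEigenfunction-scale n λ′ k {g} eigen x = begin
  ⅓ * Lap n (λ z → k * g z) x ≡⟨ cong (⅓ *_) (Lap-scale n k g x) ⟩
  ⅓ * (k * Lap n g x)         ≡⟨ commute ⅓ k (Lap n g x) ⟩
  k * ΔH n g x                ≡⟨ cong (k *_) (eigen x) ⟩
  k * (λ′ * g x)              ≡⟨ commute k λ′ (g x) ⟩
  λ′ * (k * g x)              ∎
  where
  open ≡-Reasoning
  ⅓ = ℤ.+ 1 Q./ 3
  commute : ∀ a b c → a * (b * c) ≡ b * (a * c)
  commute = solve-∀ ℚ-ring

IsEigenbasis-rescale : ∀ n λ′ φ ψ → Rescaling n φ ψ → IsEigenbasis n λ′ ψ → IsEigenbasis n λ′ φ
IsEigenbasis-rescale n λ′ φ ψ (ε , sign) (eigen , independent , spanning) = eigen′ , independent′ , spanning′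
  where
  reassoc : ∀ a b c → a * (b * c) ≡ (a * b) * c
  reassoc a b c = sym (ℚP.*-assoc a b c)
  square : ∀ a e b → e * e ≡ 1ℚ → (a * e) * (e * b) ≡ a * b
  square a e b e²≡1 = trans (regroup a e b) (trans (cong (λ q → a * (q * b)) e²≡1) (cong (a *_) (ℚP.*-identityˡ b)))
    where
    regroup : ∀ a e b → (a * e) * (e * b) ≡ a * ((e * e) * b)
    regroup = solve-∀ ℚ-ring
  eigen′ : ∀ k → 2 ℕ.≤ k → k ℕ.≤ n → ∀ u → IsEigenfunction n λ′ (φ k u)
  eigen′ k 2≤k k≤n u x =
    trans (ΔH-cong n x (proj₂ (sign k 2≤k k≤n u)))
          (trans (IsEigenfunction-scale n λ′ (ε k u) (eigen k 2≤k k≤n u) x) (cong (λ′ *_) (sym (proj₂ (sign k 2≤k k≤n u) x))))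
  independent′ : ∀ c → (∀ x → linComb n c φ x ≡ 0ℚ) → ∀ k → 2 ℕ.≤ k → k ℕ.≤ n → ∀ u → c k u ≡ 0ℚ
  independent′ c vanish k 2≤k k≤n u = begin
    c k u                     ≡⟨ sym (ℚP.*-identityʳ (c k u)) ⟩
    c k u * 1ℚ                ≡⟨ cong (c k u *_) (sym (proj₁ (sign k 2≤k k≤n u))) ⟩
    c k u * (ε k u * ε k u)   ≡⟨ reassoc (c k u) (ε k u) (ε k u) ⟩
    (c k u * ε k u) * ε k u   ≡⟨ cong (_* ε k u) (independent cε vanish′ k 2≤k k≤n u) ⟩
    0ℚ * ε k u                ≡⟨ ℚP.*-zeroˡ (ε k u) ⟩
    0ℚ                        ∎
    where
    open ≡-Reasoning
    cε : Coeffs n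
    cε k u = c k u * ε k u
    vanish′ : ∀ x → linComb n cε ψ x ≡ 0ℚ
    vanish′ x = trans (sumBasis-cong n λ k u 2≤k k≤n →
                         trans (sym (reassoc (c k u) (ε k u) (ψ k u x))) (cong (c k u *_) (sym (proj₂ (sign k 2≤k k≤n u) x))))
                      (vanish x)
  spanning′ : ∀ f → IsEigenfunction n λ′ f → ∃ λ c → ∀ x → f x ≡ linComb n c φ x
  spanning′ f eigen-f with spanning f eigen-f
  ... | d , f≡Σdψ = (λ k u → d k u * ε k u) , λ x → trans (f≡Σdψ x) (sumBasis-cong n λ k u 2≤k k≤n →
          sym (trans (cong ((d k u * ε k u) *_) (proj₂ (sign k 2≤k k≤n u) x)) (square (d k u) (ε k u) (ψ k u x) (proj₁ (sign k 2≤k k≤n u)))))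

-- Off the index range the sign is a junk 0; it is only ever used for 2 ≤ k ≤ n.
signOf : ∀ n (φ : Family n) → AllAlternating n φ → Coeffs n
signOf n φ alt k u with 2 ℕ.≤? k | k ℕ.≤? n
... | yes 2≤k | yes k≤n = proj₁ (alternating≡±cycle n k u (φ k u) 2≤k k≤n (alt k 2≤k k≤n u))
... | yes _   | no _    = 0ℚ
... | no _    | _       = 0ℚ

alternating-rescaling : ∀ n (φ : Family n) → AllAlternating n φ → Rescaling n φ (cycleFamily n)
alternating-rescaling n φ alt = signOf n φ alt , spec
  where
  spec : ∀ k → 2 ℕ.≤ k → k ℕ.≤ n → ∀ u → (signOf n φ alt k u * signOf n φ alt k u ≡ 1ℚ)
                                          × (∀ x → φ k u x ≡ signOf n φ alt k u * cycle (toList u) x)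
  spec k 2≤k k≤n u with 2 ℕ.≤? k | k ℕ.≤? n
  ... | yes 2≤k′ | yes k≤n′ = proj₂ (alternating≡±cycle n k u (φ k u) 2≤k′ k≤n′ (alt k 2≤k′ k≤n′ u))
  ... | yes _    | no k≰n   = ⊥-elim (k≰n k≤n)
  ... | no 2≰k   | _        = ⊥-elim (2≰k 2≤k)

-- Opened only here: ℤ's +_ would make right sections x +_ ambiguous.
open import Data.Nat using (_≤_; _^_; _/_)
open import Data.Integer using (+_)
open import Data.List using (length)
open import Data.Rational using () renaming (_/_ to _/ℚ_)


length-concatMap : ∀ {A B : Set} (g : A → List B) xs → length (concatMap g xs) ≡ sum (map (λ x → length (g x)) xs)
length-concatMap g []       = refl
length-concatMap g (x ∷ xs) = trans (LP.length-++ (g x)) (cong (length (g x) ℕ.+_) (length-concatMap g xs))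

length-allWords : ∀ j → length (allWords j) ≡ 3 ^ j
length-allWords zero    = refl
length-allWords (suc j) =
  trans (length-concatMap (λ a → map (a ∷_) (allWords j)) (allFin 3))
        (trans (cong₂ ℕ._+_ (copy 𝟎) (cong₂ ℕ._+_ (copy 𝟏) (cong (ℕ._+ 0) (copy 𝟐)))) (triple (3 ^ j)))
  where
  copy : ∀ a → length (map (a ∷_) (allWords j)) ≡ 3 ^ j
  copy a = trans (LP.length-map (a ∷_) (allWords j)) (length-allWords j)
  triple : ∀ x → x ℕ.+ (x ℕ.+ (x ℕ.+ 0)) ≡ 3 ℕ.* x
  triple = NS.solve-∀

-- The number of basis indices of level N + 1: Σ_{i < N} 3^(N − 1 − i) = (3^N − 1) / 2.
indexCount : ℕ → ℕ
indexCount N = sum (applyUpTo (λ i → 3 ^ (N ∸ suc i)) N)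

indexCount-closed : ∀ N → 2 ℕ.* indexCount N ℕ.+ 1 ≡ 3 ^ N
indexCount-closed zero    = refl
indexCount-closed (suc N) =
  trans (regroup (3 ^ N) (indexCount N)) (trans (cong (ℕ._+ 2 ℕ.* 3 ^ N) (indexCount-closed N)) (triple (3 ^ N)))
  where
  regroup : ∀ a t → 2 ℕ.* (a ℕ.+ t) ℕ.+ 1 ≡ (2 ℕ.* t ℕ.+ 1) ℕ.+ 2 ℕ.* a
  regroup = NS.solve-∀
  triple : ∀ a → a ℕ.+ 2 ℕ.* a ≡ 3 ℕ.* a
  triple = NS.solve-∀

sum-map-cong : ∀ {A : Set} {g h : A → ℕ} xs → (∀ x → g x ≡ h x) → sum (map g xs) ≡ sum (map h xs)
sum-map-cong xs g≗h = cong sum (LP.map-cong g≗h xs)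

length-basisIndices-suc : ∀ N → length (basisIndices (suc N)) ≡ indexCount N
length-basisIndices-suc N =
  trans (length-concatMap (λ k → map (k ,_) (allWords (suc N ∸ k))) (scales (suc N)))
  (trans (sum-map-cong (scales (suc N))
            (λ k → trans (LP.length-map {B = Σ ℕ (λ k → Word (suc N ∸ k))} (k ,_) (allWords (suc N ∸ k))) (length-allWords (suc N ∸ k))))
  (trans (cong sum (sym (LP.map-∘ (upTo N))))
         (cong sum (LP.map-applyUpTo (λ i → i) (λ i → 3 ^ (suc N ∸ (2 ℕ.+ i))) N))))

length-basisIndices : ∀ n → 2 ≤ n → length (basisIndices n) ≡ (3 ^ (n ∸ 1) ∸ 1) / 2
length-basisIndices (suc N) _ =
  trans (length-basisIndices-suc N)
        (sym (trans (cong (_/ 2) 3^N-1≡2T) (trans (cong (_/ 2) (ℕP.*-comm 2 (indexCount N))) (ℕD.m*n/n≡m (indexCount N) 2))))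
  where
  3^N-1≡2T : 3 ^ N ∸ 1 ≡ 2 ℕ.* indexCount N
  3^N-1≡2T = trans (cong (_∸ 1) (sym (indexCount-closed N))) (ℕP.m+n∸n≡m (2 ℕ.* indexCount N) 1)

ΔH-eigen⇒Lap-eigen : ∀ n f x → ΔH n f x ≡ (- (+ 5 /ℚ 3)) * f x → Lap n f x ≡ -5ℚ * f x
ΔH-eigen⇒Lap-eigen n f x e = trans (triple (Lap n f x)) (trans (cong (3ℚ *_) e) (fifths (f x)))
  where
  triple : ∀ L → L ≡ 3ℚ * ((+ 1 /ℚ 3) * L)
  triple = solve-∀ ℚ-ring
  fifths : ∀ f → 3ℚ * ((- (+ 5 /ℚ 3)) * f) ≡ -5ℚ * f
  fifths = solve-∀ ℚ-ring

length+2≤n : ∀ n k (u : Word (n ∸ k)) → 2 ≤ k → k ≤ n → L.length (toList u) ℕ.+ 2 ≤ n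
length+2≤n n k u 2≤k k≤n = subst (λ z → z ℕ.+ 2 ≤ n) (sym (VecP.length-toList u))
  (ℕP.≤-trans (ℕP.+-monoʳ-≤ (n ∸ k) 2≤k) (ℕP.≤-reflexive (ℕP.m∸n+n≡m k≤n)))

cycleFamily-eigenbasis : ∀ n → 2 ≤ n → IsEigenbasis n (- (+ 5 /ℚ 3)) (cycleFamily n)
cycleFamily-eigenbasis n 2≤n = eigen , cycleComb-independent n , spanning n 2≤n
  where
  eigen : ∀ k → 2 ≤ k → k ≤ n → ∀ u → IsEigenfunction n (- (+ 5 /ℚ 3)) (cycle (toList u))
  eigen k 2≤k k≤n u x =
    trans (cong ((+ 1 /ℚ 3) *_) (Lap-cycle n (toList u) (length+2≤n n k u 2≤k k≤n) x)) (thirds (cycle (toList u) x))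
    where
    thirds : ∀ s → (+ 1 /ℚ 3) * (-5ℚ * s) ≡ (- (+ 5 /ℚ 3)) * s
    thirds = solve-∀ ℚ-ring
  spanning : ∀ n → 2 ≤ n → ∀ f → IsEigenfunction n (- (+ 5 /ℚ 3)) f → ∃ λ c → ∀ x → f x ≡ cycleComb n c x
  spanning (suc zero)    (ℕ.s≤s ())
  spanning (suc (suc m)) _ f eigen-f = cycleComb-span m f (λ x → ΔH-eigen⇒Lap-eigen (suc (suc m)) f x (eigen-f x))

corollary6p7 : (n : ℕ) → 2 ≤ n →
    (length (basisIndices n) ≡ (3 ^ (n ∸ 1) ∸ 1) / 2)
    × (Σ (Family n) λ φ → AllAlternating n φ)
    × ((φ : Family n) → AllAlternating n φ → IsEigenbasis n (- (+ 5 /ℚ 3)) φ)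
corollary6p7 n 2≤n =
  length-basisIndices n 2≤n ,
  (cycleFamily n , λ k 2≤k k≤n u → cycle-isAlternating n k u 2≤k k≤n) ,
  λ φ alt → IsEigenbasis-rescale n (- (+ 5 /ℚ 3)) φ (cycleFamily n) (alternating-rescaling n φ alt) (cycleFamily-eigenbasis n 2≤n)
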